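{- Let $\mathcal{P}(3^3)$ be the graph whose vertices are the partitions of $\{1,\ldots,9\}$ into three cells of size three, two partitions being adjacent if and only if each cell of one partition contains exactly one point from each cell of the other. For $1\le i<j\le 9$ let $S_{i,j}$ be the set of vertices (partitions) in which $i$ and $j$ lie in the same cell. Then every independent set of size $70$ in $\mathcal{P}(3^3)$ equals $S_{i,j}$ for some $1\le i<j\le 9$.
   Context: $\mathcal{P}(3^3)$ has $280$ vertices and is regular of valency $36$. Each $S_{i,j}$ has $70$ elements and is an independent set. -}

module Defs where

open import Data.Nat using (ℕ; zero; suc; _+_)
open import Data.Bool using (Bool; true; false; _∧_)
open import Data.Fin using (Fin)
open import Data.Vec using (Vec; lookup; tabulate; []; _∷_)
open import Data.Product using (_×_)
open import Relation.Binary.PropositionalEquality using (_≡_)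

countTrue : ∀ {n} → Vec Bool n → ℕ
countTrue [] = 0
countTrue (true ∷ v) = suc (countTrue v)
countTrue (false ∷ v) = countTrue v

-- A partition of the 9-point set {0,…,8} is encoded canonically by its
-- "same cell" relation, stored as a 9×9 Boolean matrix.
Rel9 : Set
Rel9 = Vec (Vec Bool 9) 9

cell : Rel9 → Fin 9 → Vec Bool 9
cell R i = lookup R i

SameCell : Rel9 → Fin 9 → Fin 9 → Set
SameCell R i j = lookup (lookup R i) j ≡ true

-- R is the same-cell relation of a partition of {0,…,8} into three cells of
-- size three: an equivalence relation all of whose classes have size 3
-- (hence exactly 9/3 = 3 cells).
IsPartition333 : Rel9 → Set
IsPartition333 R =
  (∀ i → SameCell R i i) ×
  (∀ i j → SameCell R i j → SameCell R j i) ×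
  (∀ i j k → SameCell R i j → SameCell R j k → SameCell R i k) ×
  (∀ i → countTrue (cell R i) ≡ 3)

meet : Rel9 → Rel9 → Fin 9 → Fin 9 → ℕ
meet R R' i j = countTrue (tabulate λ k → lookup (cell R i) k ∧ lookup (cell R' j) k)

-- adjacency in P(3^3): every cell of R contains exactly one point from every
-- cell of R' (every cell is the cell of some point, so we quantify over points)
Adjacent : Rel9 → Rel9 → Set
Adjacent R R' = ∀ i j → meet R R' i j ≡ 1

{-# OPTIONS --safe #-}
-- A partition of the nine points into three triples is the partition of a labelling of the points
-- by {0,1,2} using each label three times. It has exactly one canonical labelling (point 0 gets
-- label 0 and label 1 is used before label 2), and there are 280 canonical labellings. For two
-- such partitions, adjacency means that no two points share a cell in both. The 280 partitions
-- split into 70 cliques of four pairwise adjacent partitions (the parallel classes of affine planes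
-- of order 3). An independent set meets each clique at most once, so one of size 70 picks exactly
-- one partition from every clique. A backtracking search over the cliques, recorded as a
-- certificate that is checked by evaluation, shows that whenever one partition is picked from each
-- clique with no two adjacent, some pair i < j shares a cell in all 70 picked partitions. Every
-- other partition is adjacent to the picked one of its clique, so it lies neither in the set nor,
-- by the adjacency criterion, in S_{i,j}: the set is S_{i,j}.
module Submission where

open import Defs
open import Data.Nat using (ℕ; zero; suc; _+_; _≤_; _<_; z≤n; s≤s; s≤s⁻¹; _≡ᵇ_; _<ᵇ_)
open import Data.Nat.Properties
  using (+-suc; +-cancelˡ-≡; ≤-trans; ≤-reflexive; n≤1+n; 1+n≰n; ≡ᵇ⇒≡; ≡⇒≡ᵇ; <ᵇ⇒<; <-irrefl; m⊓n≤n)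
open import Data.Nat.Show using (readMaybe)
open import Data.Fin using (Fin; zero; suc; _≟_; toℕ; fromℕ<; inject; Fin′; punchOut)
import Data.Fin as Fin
open import Data.Fin.Patterns using (0F; 1F; 2F)
open import Data.Fin.Properties
  using (toℕ<n; 0≢1+n; suc-injective; ¬∀⟶∃¬-smallest; any?; pigeonhole; punchOut-injective; <⇒≢)
open import Data.Bool using (Bool; true; false; _∧_; _∨_; T)
import Data.Bool as Bool
open import Data.Bool.Properties using (T-∧; T-≡; ⇔→≡; ¬-not)
open import Data.Bool.ListAction using (all; any)
open import Data.Vec using (Vec; []; _∷_; lookup; tabulate; map; zipWith)
import Data.Vec as Vec
open import Data.Vec.Properties using (lookup∘tabulate; lookup-map; lookup-zipWith)
open import Data.Vec.Relation.Binary.Pointwise.Extensional using (ext; Pointwise-≡⇒≡)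
open import Data.List using (List; []; _∷_; length; allFin; cartesianProductWith; filter; null)
import Data.List as List
open import Data.List.Relation.Unary.All using (All; []; _∷_)
import Data.List.Relation.Unary.All as All
open import Data.List.Relation.Unary.All.Properties using (all⁺; all⁻)
open import Data.List.Relation.Unary.Any using (Any; here; there)
import Data.List.Relation.Unary.Any as Any
open import Data.List.Relation.Unary.Any.Properties using (any⁻; lookup-index)
open import Data.List.Relation.Unary.AllPairs using ([]; _∷_)
open import Data.List.Relation.Unary.Unique.Propositional using (Unique)
open import Data.List.Membership.Propositional using (_∈_; find)
open import Data.List.Membership.Propositional.Properties
  using (∈-allFin; ∈-upTo⁺; ∈-lookup; ∈-map⁺; ∈-filter⁺; ∈-cartesianProductWith⁺)
open import Data.Product using (∃; ∃₂; ∃-syntax; _×_; _,_; proj₁; proj₂)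
import Data.Product as Product
open import Data.Product.Function.NonDependent.Propositional using (_×-⇔_)
open import Data.Sum using (_⊎_; inj₁; inj₂; [_,_]′)
import Data.Sum as Sum
open import Data.Maybe using (Maybe; just; nothing; fromMaybe)
import Data.Maybe as Maybe
open import Data.String using (String)
import Data.String as String
open import Data.Empty using (⊥; ⊥-elim)
open import Data.Unit using (tt)
open import Function using (_∘_; id)
open import Function.Bundles using (_⇔_; mk⇔; Equivalence)
import Function.Properties.Equivalence as ⇔
open import Relation.Nullary using (¬_; Dec; yes; no; does; contradiction)
open import Relation.Nullary.Decidable using (dec-true; dec-false; does-⇔; T?)
open import Relation.Binary.PropositionalEquality
  using (_≡_; _≢_; refl; sym; trans; cong; cong₂; subst; subst₂; module ≡-Reasoning)
open ≡-Reasoning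

does≡true⇔ : ∀ {A : Set} (a? : Dec A) → does a? ≡ true ⇔ A
does≡true⇔ (yes a) = mk⇔ (λ _ → a) (λ _ → refl)
does≡true⇔ (no ¬a) = mk⇔ (λ ()) (⊥-elim ∘ ¬a)

T-does⇒ : ∀ {A : Set} (a? : Dec A) → T (does a?) → A
T-does⇒ (yes a) _ = a

≡does : ∀ {A : Set} {b} → (b ≡ true ⇔ A) → (a? : Dec A) → b ≡ does a?
≡does {b = b} b⇔A = does-⇔ (mk⇔ (Equivalence.to b⇔A ∘ Equivalence.to T-≡)
                                (Equivalence.from T-≡ ∘ Equivalence.from b⇔A)) (T? b)

∧≡true⇔ : ∀ {x y} → x ∧ y ≡ true ⇔ (x ≡ true × y ≡ true)
∧≡true⇔ {true} = mk⇔ (refl ,_) proj₂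
∧≡true⇔ {false} = mk⇔ (λ ()) λ { (() , _) }

lookup-ext : ∀ {A : Set} {n} (xs ys : Vec A n) → (∀ k → lookup xs k ≡ lookup ys k) → xs ≡ ys
lookup-ext xs ys xs≗ys = Pointwise-≡⇒≡ {xs = xs} {ys} (ext xs≗ys)

all-allFin : ∀ {n} (p : Fin n → Bool) → T (all p (allFin n)) → ∀ i → T (p i)
all-allFin p ok i = All.lookup (all⁺ p (allFin _) ok) (∈-allFin i)

any-allFin : ∀ {n} (p : Fin n → Bool) → T (any p (allFin n)) → ∃ λ i → T (p i)
any-allFin p ok = Any.satisfied (any⁻ p (allFin _) ok)

nthOr : ∀ {A : Set} → A → List A → ℕ → A
nthOr d [] _ = d
nthOr d (x ∷ _) zero = x
nthOr d (_ ∷ xs) (suc n) = nthOr d xs n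

nthOr-lookup : ∀ {A : Set} (d : A) xs i → nthOr d xs (toℕ i) ≡ List.lookup xs i
nthOr-lookup d (x ∷ _) zero = refl
nthOr-lookup d (_ ∷ xs) (suc i) = nthOr-lookup d xs i

countTrue-full : ∀ {n} (v : Vec Bool n) → (∀ k → lookup v k ≡ true) → countTrue v ≡ n
countTrue-full [] _ = refl
countTrue-full (true ∷ v) full = cong suc (countTrue-full v (full ∘ suc))
countTrue-full (false ∷ v) full with full zero
... | ()

countTrue-none : ∀ {n} (v : Vec Bool n) → (∀ k → lookup v k ≢ true) → countTrue v ≡ 0
countTrue-none [] _ = refl
countTrue-none (true ∷ v) none = ⊥-elim (none zero refl)
countTrue-none (false ∷ v) none = countTrue-none v (none ∘ suc)

countTrue-≤1 : ∀ {n} (v : Vec Bool n) →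
  (∀ k k′ → lookup v k ≡ true → lookup v k′ ≡ true → k ≡ k′) → countTrue v ≤ 1
countTrue-≤1 [] _ = z≤n
countTrue-≤1 (true ∷ v) unique =
  s≤s (≤-reflexive (countTrue-none v λ k p → 0≢1+n (unique zero (suc k) refl p)))
countTrue-≤1 (false ∷ v) unique =
  countTrue-≤1 v λ k k′ p q → suc-injective (unique (suc k) (suc k′) p q)

1≤countTrue : ∀ {n} (v : Vec Bool n) k → lookup v k ≡ true → 1 ≤ countTrue v
1≤countTrue (true ∷ v) _ _ = s≤s z≤n
1≤countTrue (false ∷ v) (suc k) p = 1≤countTrue v k p

2≤countTrue : ∀ {n} (v : Vec Bool n) {k k′} → k ≢ k′ →
  lookup v k ≡ true → lookup v k′ ≡ true → 2 ≤ countTrue v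
2≤countTrue (true ∷ v) {zero} {zero} k≢k′ _ _ = ⊥-elim (k≢k′ refl)
2≤countTrue (true ∷ v) {zero} {suc k′} _ _ q = s≤s (1≤countTrue v k′ q)
2≤countTrue (true ∷ v) {suc k} {zero} _ p _ = s≤s (1≤countTrue v k p)
2≤countTrue (true ∷ v) {suc k} {suc k′} k≢k′ p q =
  ≤-trans (2≤countTrue v (k≢k′ ∘ cong suc) p q) (n≤1+n _)
2≤countTrue (false ∷ v) {suc k} {suc k′} k≢k′ p q = 2≤countTrue v (k≢k′ ∘ cong suc) p q

countTrue-mono : ∀ {n} (u w : Vec Bool n) →
  (∀ k → lookup u k ≡ true → lookup w k ≡ true) → countTrue u ≤ countTrue w
countTrue-mono [] [] _ = z≤n
countTrue-mono (true ∷ u) (true ∷ w) u⊆w = s≤s (countTrue-mono u w (u⊆w ∘ suc))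
countTrue-mono (true ∷ u) (false ∷ w) u⊆w with u⊆w zero refl
... | ()
countTrue-mono (false ∷ u) (true ∷ w) u⊆w = ≤-trans (countTrue-mono u w (u⊆w ∘ suc)) (n≤1+n _)
countTrue-mono (false ∷ u) (false ∷ w) u⊆w = countTrue-mono u w (u⊆w ∘ suc)

countTrue-⊆-≥⇒⊇ : ∀ {n} (u w : Vec Bool n) →
  (∀ k → lookup u k ≡ true → lookup w k ≡ true) → countTrue w ≤ countTrue u →
  ∀ k → lookup w k ≡ true → lookup u k ≡ true
countTrue-⊆-≥⇒⊇ (true ∷ u) (_ ∷ w) _ _ zero _ = refl
countTrue-⊆-≥⇒⊇ (false ∷ u) (true ∷ w) u⊆w w≤u zero _ =
  ⊥-elim (1+n≰n (≤-trans w≤u (countTrue-mono u w (u⊆w ∘ suc))))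
countTrue-⊆-≥⇒⊇ (true ∷ u) (true ∷ w) u⊆w w≤u (suc k) =
  countTrue-⊆-≥⇒⊇ u w (u⊆w ∘ suc) (s≤s⁻¹ w≤u) k
countTrue-⊆-≥⇒⊇ (true ∷ u) (false ∷ w) u⊆w _ (suc k) _ with u⊆w zero refl
... | ()
countTrue-⊆-≥⇒⊇ (false ∷ u) (true ∷ w) u⊆w w≤u (suc k) =
  countTrue-⊆-≥⇒⊇ u w (u⊆w ∘ suc) (≤-trans (n≤1+n _) w≤u) k
countTrue-⊆-≥⇒⊇ (false ∷ u) (false ∷ w) u⊆w w≤u (suc k) =
  countTrue-⊆-≥⇒⊇ u w (u⊆w ∘ suc) w≤u k

-- Partitions given by labellings

Labelling : Set
Labelling = Vec (Fin 3) 9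

partition : Labelling → Rel9
partition l = tabulate λ i → tabulate λ j → does (lookup l i ≟ lookup l j)

partition-entry : ∀ l i j → lookup (cell (partition l) i) j ≡ does (lookup l i ≟ lookup l j)
partition-entry l i j =
  trans (cong (λ row → lookup row j)
               (lookup∘tabulate (λ i → tabulate λ j → does (lookup l i ≟ lookup l j)) i))
        (lookup∘tabulate (λ j → does (lookup l i ≟ lookup l j)) j)

sameCell-partition : ∀ l {i j} → SameCell (partition l) i j ⇔ lookup l i ≡ lookup l j
sameCell-partition l {i} {j} =
  subst (λ b → (b ≡ true) ⇔ (lookup l i ≡ lookup l j)) (sym (partition-entry l i j))
    (does≡true⇔ (lookup l i ≟ lookup l j))

labelClass : ∀ {n} → Fin 3 → Vec (Fin 3) n → Vec Bool n
labelClass a = map λ x → does (a ≟ x)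

withLabel : ∀ {n} → Vec Bool n → Vec (Fin 3) n → Fin 3 → Vec Bool n
withLabel v l b = zipWith (λ x y → x ∧ does (b ≟ y)) v l

jointClass : ∀ {n} → Fin 3 → Fin 3 → Vec (Fin 3) n → Vec (Fin 3) n → Vec Bool n
jointClass a b l l′ = withLabel (labelClass a l) l′ b

Balanced : ∀ {n} → Vec (Fin 3) n → Set
Balanced l = ∀ a → countTrue (labelClass a l) ≡ 3

balanced? : ∀ {n} → Vec (Fin 3) n → Bool
balanced? l = all (λ a → countTrue (labelClass a l) ≡ᵇ 3) (allFin 3)

balanced?-sound : ∀ {n} (l : Vec (Fin 3) n) → T (balanced? l) → Balanced l
balanced?-sound l ok a = ≡ᵇ⇒≡ _ 3 (all-allFin (λ a → countTrue (labelClass a l) ≡ᵇ 3) ok a)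

balanced?-complete : ∀ {n} (l : Vec (Fin 3) n) → Balanced l → T (balanced? l)
balanced?-complete l balanced =
  all⁻ (λ a → countTrue (labelClass a l) ≡ᵇ 3) {xs = allFin 3}
    (All.tabulate λ {a} _ → ≡⇒≡ᵇ _ 3 (balanced a))

jointClass-entry : ∀ {n} a b (l l′ : Vec (Fin 3) n) k →
  lookup (jointClass a b l l′) k ≡ does (a ≟ lookup l k) ∧ does (b ≟ lookup l′ k)
jointClass-entry a b l l′ k =
  trans (lookup-zipWith (λ x y → x ∧ does (b ≟ y)) k (labelClass a l) l′)
        (cong (_∧ does (b ≟ lookup l′ k)) (lookup-map k (λ x → does (a ≟ x)) l))

∈jointClass : ∀ {n} a b (l l′ : Vec (Fin 3) n) k →
  lookup (jointClass a b l l′) k ≡ true ⇔ (a ≡ lookup l k × b ≡ lookup l′ k)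
∈jointClass a b l l′ k =
  subst (λ x → (x ≡ true) ⇔ (a ≡ lookup l k × b ≡ lookup l′ k)) (sym (jointClass-entry a b l l′ k))
    (⇔.trans ∧≡true⇔ (does≡true⇔ (a ≟ lookup l k) ×-⇔ does≡true⇔ (b ≟ lookup l′ k)))

countTrue-withLabel : ∀ {n} (v : Vec Bool n) (l : Vec (Fin 3) n) →
  countTrue v ≡
    countTrue (withLabel v l 0F) + countTrue (withLabel v l 1F) + countTrue (withLabel v l 2F)
countTrue-withLabel [] [] = refl
countTrue-withLabel (false ∷ v) (_ ∷ l) = countTrue-withLabel v l
countTrue-withLabel (true ∷ v) (0F ∷ l) = cong suc (countTrue-withLabel v l)
countTrue-withLabel (true ∷ v) (1F ∷ l) =
  trans (cong suc (countTrue-withLabel v l)) (cong (_+ countTrue (withLabel v l 2F)) (sym (+-suc _ _)))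
countTrue-withLabel (true ∷ v) (2F ∷ l) = trans (cong suc (countTrue-withLabel v l)) (sym (+-suc _ _))

countTrue-labelClasses : ∀ {n} (l : Vec (Fin 3) n) →
  countTrue (labelClass 0F l) + countTrue (labelClass 1F l) + countTrue (labelClass 2F l) ≡ n
countTrue-labelClasses [] = refl
countTrue-labelClasses (0F ∷ l) = cong suc (countTrue-labelClasses l)
countTrue-labelClasses (1F ∷ l) =
  trans (cong (_+ countTrue (labelClass 2F l)) (+-suc _ _)) (cong suc (countTrue-labelClasses l))
countTrue-labelClasses (2F ∷ l) = trans (+-suc _ _) (cong suc (countTrue-labelClasses l))

meet-partition : ∀ l l′ i j →
  meet (partition l) (partition l′) i j ≡ countTrue (jointClass (lookup l i) (lookup l′ j) l l′)
meet-partition l l′ i j =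
  cong countTrue (lookup-ext common (jointClass (lookup l i) (lookup l′ j) l l′) entries)
  where
  common : Vec Bool 9
  common = tabulate λ k → lookup (cell (partition l) i) k ∧ lookup (cell (partition l′) j) k
  entries : ∀ k → lookup common k ≡ lookup (jointClass (lookup l i) (lookup l′ j) l l′) k
  entries k =
    trans (lookup∘tabulate (λ k → lookup (cell (partition l) i) k ∧ lookup (cell (partition l′) j) k) k)
          (trans (cong₂ _∧_ (partition-entry l i k) (partition-entry l′ j k))
                 (sym (jointClass-entry (lookup l i) (lookup l′ j) l l′ k)))

-- Adjacency of labelled partitions

NoCommonPair : ∀ {n} → Vec (Fin 3) n → Vec (Fin 3) n → Set
NoCommonPair l l′ = ∀ {i j} → lookup l i ≡ lookup l j → lookup l′ i ≡ lookup l′ j → i ≡ j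

adjacent⇒noCommonPair : ∀ l l′ → Adjacent (partition l) (partition l′) → NoCommonPair l l′
adjacent⇒noCommonPair l l′ adj {i} {j} li≡lj l′i≡l′j with i ≟ j
... | yes i≡j = i≡j
... | no i≢j = ⊥-elim (1+n≰n (subst (2 ≤_) meet≡1 (2≤countTrue class i≢j (∈class refl refl) (∈class li≡lj l′i≡l′j))))
  where
  class : Vec Bool 9
  class = jointClass (lookup l i) (lookup l′ i) l l′
  meet≡1 : countTrue class ≡ 1
  meet≡1 = trans (sym (meet-partition l l′ i i)) (adj i i)
  ∈class : ∀ {k} → lookup l i ≡ lookup l k → lookup l′ i ≡ lookup l′ k → lookup class k ≡ true
  ∈class {k} e e′ = Equivalence.from (∈jointClass (lookup l i) (lookup l′ i) l l′ k) (e , e′)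

≤1-sum≡3 : ∀ {x y z} → x ≤ 1 → y ≤ 1 → z ≤ 1 → x + y + z ≡ 3 → x ≡ 1 × y ≡ 1 × z ≡ 1
≤1-sum≡3 (s≤s z≤n) (s≤s z≤n) (s≤s z≤n) _ = refl , refl , refl
≤1-sum≡3 z≤n       (s≤s z≤n) (s≤s z≤n) ()
≤1-sum≡3 (s≤s z≤n) z≤n       (s≤s z≤n) ()
≤1-sum≡3 (s≤s z≤n) (s≤s z≤n) z≤n       ()
≤1-sum≡3 z≤n       z≤n       (s≤s z≤n) ()
≤1-sum≡3 z≤n       (s≤s z≤n) z≤n       ()
≤1-sum≡3 (s≤s z≤n) z≤n       z≤n       ()
≤1-sum≡3 z≤n       z≤n       z≤n       ()

-- A cell of the first partition has three points, spread over the three cells of the second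
-- with at most one point in each: so exactly one in each.
noCommonPair⇒adjacent : ∀ l l′ → Balanced l → NoCommonPair l l′ →
  Adjacent (partition l) (partition l′)
noCommonPair⇒adjacent l l′ balanced noPair i j = trans (meet-partition l l′ i j) (one (lookup l′ j))
  where
  size : Fin 3 → ℕ
  size b = countTrue (jointClass (lookup l i) b l l′)
  size≤1 : ∀ b → size b ≤ 1
  size≤1 b = countTrue-≤1 (jointClass (lookup l i) b l l′) λ k k′ p q →
    let (lk , l′k) = Equivalence.to (∈jointClass (lookup l i) b l l′ k) p
        (lk′ , l′k′) = Equivalence.to (∈jointClass (lookup l i) b l l′ k′) q
    in noPair (trans (sym lk) lk′) (trans (sym l′k) l′k′)
  sizes : size 0F + size 1F + size 2F ≡ 3
  sizes = trans (sym (countTrue-withLabel (labelClass (lookup l i) l) l′)) (balanced (lookup l i))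
  one : ∀ b → size b ≡ 1
  one 0F = proj₁ (≤1-sum≡3 (size≤1 0F) (size≤1 1F) (size≤1 2F) sizes)
  one 1F = proj₁ (proj₂ (≤1-sum≡3 (size≤1 0F) (size≤1 1F) (size≤1 2F) sizes))
  one 2F = proj₂ (proj₂ (≤1-sum≡3 (size≤1 0F) (size≤1 1F) (size≤1 2F) sizes))

noCommonPair? : ∀ {n} → Vec (Fin 3) n → Vec (Fin 3) n → Bool
noCommonPair? [] [] = true
noCommonPair? (a ∷ l) (b ∷ l′) = (countTrue (jointClass a b l l′) ≡ᵇ 0) ∧ noCommonPair? l l′

jointClass-empty : ∀ {n} a b (l l′ : Vec (Fin 3) n) → countTrue (jointClass a b l l′) ≡ 0 →
  ∀ {k} → a ≡ lookup l k → b ≡ lookup l′ k → ⊥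
jointClass-empty a b l l′ empty {k} e e′ with subst (1 ≤_) empty
  (1≤countTrue (jointClass a b l l′) k (Equivalence.from (∈jointClass a b l l′ k) (e , e′)))
... | ()

noCommonPair?-sound : ∀ {n} (l l′ : Vec (Fin 3) n) → T (noCommonPair? l l′) → NoCommonPair l l′
noCommonPair?-sound (a ∷ l) (b ∷ l′) _ {zero} {zero} _ _ = refl
noCommonPair?-sound (a ∷ l) (b ∷ l′) ok {zero} {suc j} e e′ =
  ⊥-elim (jointClass-empty a b l l′ (≡ᵇ⇒≡ _ 0 (proj₁ (Equivalence.to T-∧ ok))) e e′)
noCommonPair?-sound (a ∷ l) (b ∷ l′) ok {suc i} {zero} e e′ =
  ⊥-elim (jointClass-empty a b l l′ (≡ᵇ⇒≡ _ 0 (proj₁ (Equivalence.to T-∧ ok))) (sym e) (sym e′))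
noCommonPair?-sound (a ∷ l) (b ∷ l′) ok {suc i} {suc j} e e′ =
  cong suc (noCommonPair?-sound l l′ (proj₂ (Equivalence.to T-∧ ok)) e e′)

-- Canonical labellings

firstNonzeroIsOne : ∀ {n} → Vec (Fin 3) n → Bool
firstNonzeroIsOne [] = true
firstNonzeroIsOne (0F ∷ l) = firstNonzeroIsOne l
firstNonzeroIsOne (1F ∷ l) = true
firstNonzeroIsOne (2F ∷ l) = false

firstNonzeroIsOne-intro : ∀ {n} (l : Vec (Fin 3) n) c →
  (∀ (j : Fin′ c) → lookup l (inject j) ≡ 0F) → lookup l c ≡ 1F → T (firstNonzeroIsOne l)
firstNonzeroIsOne-intro (_ ∷ l) zero _ refl = tt
firstNonzeroIsOne-intro (_ ∷ l) (suc c) before at with before zero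
... | refl = firstNonzeroIsOne-intro l c (before ∘ suc) at

canonical? : Labelling → Bool
canonical? l = firstNonzeroIsOne l ∧ balanced? l

labellings : ∀ n → List (Vec (Fin 3) n)
labellings zero = [] ∷ []
labellings (suc n) = cartesianProductWith _∷_ (allFin 3) (labellings n)

∈-labellings : ∀ {n} (l : Vec (Fin 3) n) → l ∈ labellings n
∈-labellings [] = here refl
∈-labellings (x ∷ l) = ∈-cartesianProductWith⁺ _∷_ (∈-allFin x) (∈-labellings l)

candidates : List Labelling
candidates = List.map (0F ∷_) (labellings 8)

∈-candidates : ∀ l → 0F ∷ l ∈ candidates
∈-candidates l = ∈-map⁺ (λ (l : Vec (Fin 3) 8) → 0F ∷ l) {xs = labellings 8} (∈-labellings l)

-- The restricted-growth labellings, one per partition, in lexicographic order.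
canonicalLabellings : List Labelling
canonicalLabellings = filter (T? ∘ canonical?) candidates

classOf : Bool → Bool → Fin 3
classOf true _ = 0F
classOf false true = 1F
classOf false false = 2F

classOf≡0 : ∀ x y → classOf x y ≡ 0F → x ≡ true
classOf≡0 true _ _ = refl
classOf≡0 false true ()
classOf≡0 false false ()

classOf≡1 : ∀ x y → classOf x y ≡ 1F → y ≡ true
classOf≡1 true _ ()
classOf≡1 false true _ = refl
classOf≡1 false false ()

module CanonicalLabelling {R : Rel9} (isP : IsPartition333 R) where
  private
    reflexive : ∀ i → SameCell R i i
    reflexive = proj₁ isP
    symmetric : ∀ i j → SameCell R i j → SameCell R j i
    symmetric = proj₁ (proj₂ isP)
    transitive : ∀ i j k → SameCell R i j → SameCell R j k → SameCell R i k
    transitive = proj₁ (proj₂ (proj₂ isP))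
    cellSize : ∀ i → countTrue (cell R i) ≡ 3
    cellSize = proj₂ (proj₂ (proj₂ isP))

  sameRow : ∀ {i j} → SameCell R i j → ∀ a → lookup (cell R a) i ≡ lookup (cell R a) j
  sameRow {i} {j} i~j a =
    ⇔→≡ (mk⇔ (λ a~i → transitive a i j a~i i~j) (λ a~j → transitive a j i a~j (symmetric i j i~j)))

  -- Taking the smallest point outside the cell of 0 makes the labelling below restricted-growth.
  outsider : ∃ λ c → ¬ SameCell R 0F c × (∀ (j : Fin′ c) → SameCell R 0F (inject j))
  outsider = ¬∀⟶∃¬-smallest 9 (SameCell R 0F) (λ k → lookup (cell R 0F) k Bool.≟ true)
    λ all~ → contradiction (trans (sym (cellSize 0F)) (countTrue-full (cell R 0F) all~)) λ ()

  c : Fin 9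
  c = proj₁ outsider

  canonical : Labelling
  canonical = tabulate λ k → classOf (lookup (cell R 0F) k) (lookup (cell R c) k)

  canonical-entry : ∀ k → lookup canonical k ≡ classOf (lookup (cell R 0F) k) (lookup (cell R c) k)
  canonical-entry = lookup∘tabulate _

  sameCell⇒sameLabel : ∀ {i j} → SameCell R i j → lookup canonical i ≡ lookup canonical j
  sameCell⇒sameLabel {i} {j} i~j = trans (canonical-entry i)
    (trans (cong₂ classOf (sameRow i~j 0F) (sameRow i~j c)) (sym (canonical-entry j)))

  class₀ : labelClass 0F canonical ≡ cell R 0F
  class₀ = lookup-ext (labelClass 0F canonical) (cell R 0F) λ k →
    trans (lookup-map k (λ x → does (0F ≟ x)) canonical)
      (trans (cong (λ x → does (0F ≟ x)) (canonical-entry k))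
        (is0 (lookup (cell R 0F) k) (lookup (cell R c) k)))
    where
    is0 : ∀ x y → does (0F ≟ classOf x y) ≡ x
    is0 true _ = refl
    is0 false true = refl
    is0 false false = refl

  class₁ : labelClass 1F canonical ≡ cell R c
  class₁ = lookup-ext (labelClass 1F canonical) (cell R c) λ k →
    trans (lookup-map k (λ x → does (1F ≟ x)) canonical)
      (trans (cong (λ x → does (1F ≟ x)) (canonical-entry k))
        (is1 (lookup (cell R 0F) k) (lookup (cell R c) k) (disjoint k)))
    where
    disjoint : ∀ k → SameCell R 0F k → SameCell R c k → ⊥
    disjoint k 0~k c~k = proj₁ (proj₂ outsider) (transitive 0F k c 0~k (symmetric c k c~k))
    is1 : ∀ x y → (x ≡ true → y ≡ true → ⊥) → does (1F ≟ classOf x y) ≡ y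
    is1 true true disj = ⊥-elim (disj refl refl)
    is1 true false _ = refl
    is1 false true _ = refl
    is1 false false _ = refl

  balanced : Balanced canonical
  balanced 0F = trans (cong countTrue class₀) (cellSize 0F)
  balanced 1F = trans (cong countTrue class₁) (cellSize c)
  balanced 2F = +-cancelˡ-≡ 6 _ _ (trans
    (cong₂ (λ m n → m + n + countTrue (labelClass 2F canonical)) (sym (balanced 0F)) (sym (balanced 1F)))
    (countTrue-labelClasses canonical))

  -- The points labelled 2 form the third cell: it contains the cell of any of its points, and
  -- has the same size.
  thirdCell : ∀ {i j} → lookup canonical i ≡ 2F → lookup canonical j ≡ 2F → SameCell R i j
  thirdCell {i} {j} i↦2 j↦2 =
    countTrue-⊆-≥⇒⊇ (cell R i) (labelClass 2F canonical) i~⇒↦2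
      (≤-reflexive (trans (balanced 2F) (sym (cellSize i)))) j (∈class {j} j↦2)
    where
    ∈class : ∀ {k} → lookup canonical k ≡ 2F → lookup (labelClass 2F canonical) k ≡ true
    ∈class {k} k↦2 = trans (lookup-map k (λ x → does (2F ≟ x)) canonical)
      (dec-true (2F ≟ lookup canonical k) (sym k↦2))
    i~⇒↦2 : ∀ k → SameCell R i k → lookup (labelClass 2F canonical) k ≡ true
    i~⇒↦2 k i~k = ∈class {k} (trans (sym (sameCell⇒sameLabel i~k)) i↦2)

  sameLabel⇒sameCell : ∀ {i j} → lookup canonical i ≡ lookup canonical j → SameCell R i j
  sameLabel⇒sameCell {i} {j} e with lookup canonical i in i↦ | lookup canonical j in j↦
  ... | 0F | 0F = transitive i 0F j (symmetric 0F i (0~ i i↦)) (0~ j j↦)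
    where
    0~ : ∀ k → lookup canonical k ≡ 0F → SameCell R 0F k
    0~ k k↦0 = classOf≡0 _ _ (trans (sym (canonical-entry k)) k↦0)
  ... | 1F | 1F = transitive i c j (symmetric c i (c~ i i↦)) (c~ j j↦)
    where
    c~ : ∀ k → lookup canonical k ≡ 1F → SameCell R c k
    c~ k k↦1 = classOf≡1 _ _ (trans (sym (canonical-entry k)) k↦1)
  ... | 2F | 2F = thirdCell i↦ j↦

  partition-canonical : partition canonical ≡ R
  partition-canonical = lookup-ext (partition canonical) R λ i →
    lookup-ext (lookup (partition canonical) i) (lookup R i) λ j →
      trans (partition-entry canonical i j)
        (sym (≡does (mk⇔ sameCell⇒sameLabel sameLabel⇒sameCell)
                    (lookup canonical i ≟ lookup canonical j)))

  canonical-isCanonical : T (canonical? canonical)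
  canonical-isCanonical = Equivalence.from T-∧
    (firstNonzeroIsOne-intro canonical c before at , balanced?-complete canonical balanced)
    where
    before : ∀ (j : Fin′ c) → lookup canonical (inject j) ≡ 0F
    before j = trans (canonical-entry (inject j))
      (cong (λ x → classOf x (lookup (cell R c) (inject j))) (proj₂ (proj₂ outsider) j))
    at : lookup canonical c ≡ 1F
    at = trans (canonical-entry c) (cong₂ classOf (¬-not (proj₁ (proj₂ outsider))) (reflexive c))

  canonical-∈ : canonical ∈ canonicalLabellings
  canonical-∈ = ∈-filter⁺ (T? ∘ canonical?) {xs = candidates}
    (subst (_∈ candidates) (sym startsWith0) (∈-candidates (Vec.tail canonical))) canonical-isCanonical
    where
    startsWith0 : canonical ≡ 0F ∷ Vec.tail canonical
    startsWith0 = cong (_∷ Vec.tail canonical)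
      (trans (canonical-entry 0F) (cong (λ x → classOf x (lookup (cell R c) 0F)) (reflexive 0F)))

canonicalLabelling : ∀ R → IsPartition333 R → ∃ λ l → l ∈ canonicalLabellings × partition l ≡ R
canonicalLabelling R isP = canonical , canonical-∈ , partition-canonical
  where open CanonicalLabelling {R} isP

-- Independent sets and clique covers

injective⇒surjective : ∀ {m n} (f : Fin m → Fin n) → n ≤ m → (∀ {i j} → f i ≡ f j → i ≡ j) →
  ∀ y → ∃ λ x → f x ≡ y
injective⇒surjective {m} {suc n} f n<m injective y with any? (λ x → f x ≟ y)
... | yes hit = hit
... | no miss = ⊥-elim (noCollision (pigeonhole n<m λ x → punchOut (y≢f x)))
  where
  y≢f : ∀ x → y ≢ f x
  y≢f x y≡fx = miss (x , sym y≡fx)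
  noCollision : ¬ ∃₂ λ i j → i Fin.< j × punchOut (y≢f i) ≡ punchOut (y≢f j)
  noCollision (i , j , i<j , collision) =
    <⇒≢ i<j (injective (punchOut-injective (y≢f i) (y≢f j) collision))

lookup-injective : ∀ {A : Set} {xs : List A} → Unique xs →
  ∀ {i j} → List.lookup xs i ≡ List.lookup xs j → i ≡ j
lookup-injective {xs = _ ∷ _} (_ ∷ _) {zero} {zero} _ = refl
lookup-injective {xs = _ ∷ _} (x∉ ∷ _) {zero} {suc j} e = ⊥-elim (All.lookup x∉ (∈-lookup j) e)
lookup-injective {xs = _ ∷ _} (x∉ ∷ _) {suc i} {zero} e = ⊥-elim (All.lookup x∉ (∈-lookup i) (sym e))
lookup-injective {xs = _ ∷ _} (_ ∷ unique) {suc i} {suc j} e = cong suc (lookup-injective unique e)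

module _ {A : Set} (_~_ : A → A → Set) {n s} (clique : Fin n → Fin s → A)
         (clique-adjacent : ∀ m {k k′} → k ≢ k′ → clique m k ~ clique m k′) where

  independent-meets-every-clique : (L : List A) → Unique L →
    (∀ x y → x ∈ L → y ∈ L → ¬ x ~ y) → (∀ x → x ∈ L → ∃₂ λ m k → x ≡ clique m k) →
    n ≤ length L → ∀ m → ∃ λ k → clique m k ∈ L
  independent-meets-every-clique L unique independent covered n≤|L| m =
    let (i , i↦m) = injective⇒surjective cliqueOf n≤|L| cliqueOf-injective m
    in positionOf i ,
       subst (_∈ L) (trans (at i) (cong (λ m → clique m (positionOf i)) i↦m)) (∈-lookup i)
    where
    locate : ∀ i → ∃₂ λ m k → List.lookup L i ≡ clique m k
    locate i = covered _ (∈-lookup i)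
    cliqueOf : Fin (length L) → Fin n
    cliqueOf i = proj₁ (locate i)
    positionOf : Fin (length L) → Fin s
    positionOf i = proj₁ (proj₂ (locate i))
    at : ∀ i → List.lookup L i ≡ clique (cliqueOf i) (positionOf i)
    at i = proj₂ (proj₂ (locate i))
    cliqueOf-injective : ∀ {i j} → cliqueOf i ≡ cliqueOf j → i ≡ j
    cliqueOf-injective {i} {j} same with positionOf i ≟ positionOf j
    ... | yes samePosition =
      lookup-injective unique (trans (at i) (trans (cong₂ clique same samePosition) (sym (at j))))
    ... | no differentPosition =
      ⊥-elim (independent (List.lookup L i) (List.lookup L j) (∈-lookup i) (∈-lookup j)
      (subst₂ _~_ (sym (at i)) (trans (cong (λ m → clique m (positionOf j)) same) (sym (at j)))
        (clique-adjacent (cliqueOf i) differentPosition)))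

-- Checking a search certificate

Cover : Set
Cover = Vec (Vec Labelling 4) 70

cliqueLabelling : Cover → Fin 70 → Fin 4 → Labelling
cliqueLabelling cover m k = lookup (lookup cover m) k

EqualsS : List Rel9 → Fin 9 → Fin 9 → Set
EqualsS L i j = ∀ R → IsPartition333 R → (R ∈ L ⇔ SameCell R i j)

-- A trace of the backtracking search. `branch p next` decides the p-th clique not yet decided,
-- with one subtree for each of its four partitions; `conflict n` closes a branch because the
-- partition just chosen is adjacent to the n-th one chosen before it; `done i j` says that every
-- clique is decided and all chosen partitions have i and j in a common cell.
data Certificate : Set where
  branch : ℕ → (Fin 4 → Certificate) → Certificate
  conflict : ℕ → Certificate
  done : Fin 9 → Fin 9 → Certificate

pick : ∀ {A : Set} → ℕ → List A → Maybe (A × List A)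
pick _ [] = nothing
pick zero (x ∷ xs) = just (x , xs)
pick (suc p) (x ∷ xs) = Maybe.map (Product.map₂ (x ∷_)) (pick p xs)

pick-∈ : ∀ {A : Set} p (xs : List A) {x ys} → pick p xs ≡ just (x , ys) →
  ∀ {z} → z ∈ xs → z ≡ x ⊎ z ∈ ys
pick-∈ zero (x ∷ xs) refl (here refl) = inj₁ refl
pick-∈ zero (x ∷ xs) refl (there z∈xs) = inj₂ z∈xs
pick-∈ (suc p) (x ∷ xs) picked z∈ with pick p xs in picked′
pick-∈ (suc p) (x ∷ xs) refl (here refl) | just _ = inj₂ (here refl)
pick-∈ (suc p) (x ∷ xs) refl (there z∈xs) | just _ = Sum.map₂ there (pick-∈ p xs picked′ z∈xs)

noCommonPairAt? : Labelling → List Labelling → ℕ → Bool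
noCommonPairAt? l [] _ = false
noCommonPairAt? l (l′ ∷ _) zero = noCommonPair? l l′
noCommonPairAt? l (_ ∷ ls) (suc n) = noCommonPairAt? l ls n

noCommonPairAt?-sound : ∀ l ls n → T (noCommonPairAt? l ls n) → Any (λ l′ → NoCommonPair l l′) ls
noCommonPairAt?-sound l (l′ ∷ _) zero ok = here (noCommonPair?-sound l l′ ok)
noCommonPairAt?-sound l (_ ∷ ls) (suc n) ok = there (noCommonPairAt?-sound l ls n ok)

valid : Cover → List (Fin 70) → List Labelling → Certificate → Bool
valid cover pending chosen (branch p next) with pick p pending
... | nothing = false
... | just (m , pending′) =
  all (λ k → valid cover pending′ (cliqueLabelling cover m k ∷ chosen) (next k)) (allFin 4)
valid cover pending [] (conflict n) = false
valid cover pending (l ∷ chosen) (conflict n) = noCommonPairAt? l chosen n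
valid cover pending chosen (done i j) =
  null pending ∧ (toℕ i <ᵇ toℕ j) ∧ all (λ l → does (lookup l i ≟ lookup l j)) chosen

module Search (cover : Cover)
  (balanced : ∀ m k → Balanced (cliqueLabelling cover m k))
  (clique : ∀ m {k k′} → k ≢ k′ →
    Adjacent (partition (cliqueLabelling cover m k)) (partition (cliqueLabelling cover m k′)))
  (complete : ∀ R → IsPartition333 R → ∃₂ λ m k → R ≡ partition (cliqueLabelling cover m k))
  (L : List Rel9) (independent : ∀ R R′ → R ∈ L → R′ ∈ L → ¬ Adjacent R R′)
  (meets : ∀ m → ∃ λ k → partition (cliqueLabelling cover m k) ∈ L)
  where

  Chosen : Labelling → Set
  Chosen l = Balanced l × partition l ∈ L

  Covered : List (Fin 70) → List Labelling → Set
  Covered pending chosen = ∀ m → m ∈ pending ⊎ ∃ λ k → cliqueLabelling cover m k ∈ chosen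

  inCliqueOf : ∀ {m k k′ i j} → i ≢ j → Chosen (cliqueLabelling cover m k′) →
    lookup (cliqueLabelling cover m k′) i ≡ lookup (cliqueLabelling cover m k′) j →
    partition (cliqueLabelling cover m k) ∈ L ⇔ SameCell (partition (cliqueLabelling cover m k)) i j
  inCliqueOf {m} {k} {k′} i≢j (_ , chosenInL) chosen~ with k ≟ k′
  ... | yes refl =
    mk⇔ (λ _ → Equivalence.from (sameCell-partition (cliqueLabelling cover m k)) chosen~) (λ _ → chosenInL)
  ... | no k≢k′ = mk⇔
    (λ inL → ⊥-elim (independent (partition l) (partition l′) inL chosenInL (clique m k≢k′)))
    (λ l~ → ⊥-elim (i≢j (adjacent⇒noCommonPair l l′ (clique m k≢k′)
                           (Equivalence.to (sameCell-partition l) l~) chosen~)))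
    where
    l = cliqueLabelling cover m k
    l′ = cliqueLabelling cover m k′

  equalsS : ∀ {chosen i j} → (∀ m → ∃ λ k → cliqueLabelling cover m k ∈ chosen) →
    All Chosen chosen → All (λ l → lookup l i ≡ lookup l j) chosen → i ≢ j → EqualsS L i j
  equalsS {i = i} {j} covered areChosen sameCells i≢j R isP =
    let (m , k , R≡) = complete R isP
        (k′ , k′∈) = covered m
    in subst (λ R → R ∈ L ⇔ SameCell R i j) (sym R≡)
         (inCliqueOf i≢j (All.lookup areChosen k′∈) (All.lookup sameCells k′∈))

  covered-pick : ∀ {p pending m pending′ chosen} k → pick p pending ≡ just (m , pending′) →
    Covered pending chosen → Covered pending′ (cliqueLabelling cover m k ∷ chosen)
  covered-pick {p} {pending} k picked covered m′ with covered m′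
  ... | inj₂ (k′ , k′∈) = inj₂ (k′ , there k′∈)
  ... | inj₁ m′∈ with pick-∈ p pending picked m′∈
  ...   | inj₁ refl = inj₂ (k , here refl)
  ...   | inj₂ m′∈′ = inj₁ m′∈′

  sound : ∀ pending chosen t → valid cover pending chosen t ≡ true →
    All Chosen chosen → Covered pending chosen → ∃₂ λ i j → toℕ i < toℕ j × EqualsS L i j
  sound pending chosen (branch p next) ok areChosen covered with pick p pending in picked
  ... | just (m , pending′) =
    let (k , inL) = meets m
    in sound pending′ (cliqueLabelling cover m k ∷ chosen) (next k)
         (Equivalence.to T-≡ (all-allFin (λ k → valid cover pending′ (cliqueLabelling cover m k ∷ chosen) (next k))
                                          (Equivalence.from T-≡ ok) k))
         ((balanced m k , inL) ∷ areChosen) (covered-pick k picked covered)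
  sound pending (l ∷ chosen) (conflict n) ok ((balancedL , inL) ∷ areChosen) _ =
    let (l′ , l′∈ , noPair) = find (noCommonPairAt?-sound l chosen n (Equivalence.from T-≡ ok))
    in ⊥-elim (independent (partition l) (partition l′) inL (proj₂ (All.lookup areChosen l′∈))
                 (noCommonPair⇒adjacent l l′ balancedL noPair))
  sound [] chosen (done i j) ok areChosen covered =
    let (i<ᵇj , allSame) = Equivalence.to T-∧ (Equivalence.from T-≡ ok)
        i<j = <ᵇ⇒< (toℕ i) (toℕ j) i<ᵇj
        sameCells = All.map (λ {l} → T-does⇒ (lookup l i ≟ lookup l j))
                      (all⁺ (λ l → does (lookup l i ≟ lookup l j)) chosen allSame)
    in i , j , i<j , equalsS (λ m → [ (λ ()) , id ]′ (covered m)) areChosen sameCells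
                       (λ i≡j → <-irrefl (cong toℕ i≡j) i<j)

distinctApart? : Cover → Fin 70 → Fin 4 → Fin 4 → Bool
distinctApart? cover m k k′ =
  does (k ≟ k′) ∨ noCommonPair? (cliqueLabelling cover m k) (cliqueLabelling cover m k′)

cliqueOK? : Cover → Fin 70 → Fin 4 → Bool
cliqueOK? cover m k = balanced? (cliqueLabelling cover m k) ∧ all (distinctApart? cover m k) (allFin 4)

isCliqueCover? : Cover → Bool
isCliqueCover? cover = all (λ m → all (cliqueOK? cover m) (allFin 4)) (allFin 70)

module CliqueCover (cover : Cover) (ok : isCliqueCover? cover ≡ true) where

  private
    cliqueOK : ∀ m k →
      T (balanced? (cliqueLabelling cover m k)) × T (all (distinctApart? cover m k) (allFin 4))
    cliqueOK m k = Equivalence.to T-∧ (all-allFin (cliqueOK? cover m)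
      (all-allFin (λ m → all (cliqueOK? cover m) (allFin 4)) (Equivalence.from T-≡ ok) m) k)

  balanced : ∀ m k → Balanced (cliqueLabelling cover m k)
  balanced m k = balanced?-sound (cliqueLabelling cover m k) (proj₁ (cliqueOK m k))

  clique : ∀ m {k k′} → k ≢ k′ →
    Adjacent (partition (cliqueLabelling cover m k)) (partition (cliqueLabelling cover m k′))
  clique m {k} {k′} k≢k′ = noCommonPair⇒adjacent l l′ (balanced m k) (noCommonPair?-sound l l′
    (subst (λ b → T (b ∨ noCommonPair? l l′)) (dec-false (k ≟ k′) k≢k′)
      (all-allFin (distinctApart? cover m k) (proj₂ (cliqueOK m k)) k′)))
    where
    l = cliqueLabelling cover m k
    l′ = cliqueLabelling cover m k′

inCliques? : Vec (Vec ℕ 4) 70 → ℕ → Bool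
inCliques? indices i =
  any (λ m → any (λ k → lookup (lookup indices m) k ≡ᵇ i) (allFin 4)) (allFin 70)

exhaustive? : Vec (Vec ℕ 4) 70 → ℕ → Bool
exhaustive? indices n = all (inCliques? indices) (List.upTo n)

exhaustive?-sound : ∀ indices n → exhaustive? indices n ≡ true → ∀ (i : Fin n) →
  ∃₂ λ m k → lookup (lookup indices m) k ≡ toℕ i
exhaustive?-sound indices n ok i =
  let (m , m∋i) = any-allFin (λ m → any (λ k → lookup (lookup indices m) k ≡ᵇ toℕ i) (allFin 4))
        (All.lookup (all⁺ (inCliques? indices) (List.upTo n) (Equivalence.from T-≡ ok)) (∈-upTo⁺ (toℕ<n i)))
      (k , k↦i) = any-allFin (λ k → lookup (lookup indices m) k ≡ᵇ toℕ i) m∋i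
  in m , k , ≡ᵇ⇒≡ _ _ k↦i

readℕ : String → ℕ
readℕ digits = fromMaybe 0 (readMaybe 10 digits)

readPoint : String → Fin 9
readPoint i = fromℕ< (s≤s (m⊓n≤n (readℕ i) 8))

-- Tokens "b p", "x n" and "d i j" stand for branch, conflict and done, in prefix order.
-- Malformed text parses to some certificate; only its validity matters.
parse : ℕ → List String → Certificate × List String
parse zero tokens = conflict 0 , tokens
parse (suc fuel) ("b" ∷ p ∷ tokens) =
  let (c₀ , tokens₀) = parse fuel tokens
      (c₁ , tokens₁) = parse fuel tokens₀
      (c₂ , tokens₂) = parse fuel tokens₁
      (c₃ , tokens₃) = parse fuel tokens₂
  in branch (readℕ p) (lookup (c₀ ∷ c₁ ∷ c₂ ∷ c₃ ∷ [])) , tokens₃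
parse (suc fuel) ("x" ∷ n ∷ tokens) = conflict (readℕ n) , tokens
parse (suc fuel) ("d" ∷ i ∷ j ∷ tokens) = done (readPoint i) (readPoint j) , tokens
parse (suc fuel) _ = conflict 0 , []

-- Each clique is given by the positions of its four partitions in canonicalLabellings.
cliqueIndices : Vec (Vec ℕ 4) 70
cliqueIndices =
  (38 ∷ 122 ∷ 134 ∷ 229 ∷ []) ∷
  (39 ∷ 88 ∷ 191 ∷ 175 ∷ []) ∷
  (12 ∷ 106 ∷ 258 ∷ 187 ∷ []) ∷
  (6 ∷ 199 ∷ 231 ∷ 275 ∷ []) ∷
  (15 ∷ 117 ∷ 160 ∷ 277 ∷ []) ∷
  (26 ∷ 115 ∷ 141 ∷ 222 ∷ []) ∷
  (66 ∷ 82 ∷ 138 ∷ 268 ∷ []) ∷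
  (19 ∷ 108 ∷ 168 ∷ 278 ∷ []) ∷
  (3 ∷ 196 ∷ 257 ∷ 248 ∷ []) ∷
  (27 ∷ 109 ∷ 139 ∷ 228 ∷ []) ∷
  (54 ∷ 73 ∷ 220 ∷ 185 ∷ []) ∷
  (23 ∷ 127 ∷ 142 ∷ 241 ∷ []) ∷
  (69 ∷ 89 ∷ 135 ∷ 255 ∷ []) ∷
  (5 ∷ 193 ∷ 239 ∷ 270 ∷ []) ∷
  (44 ∷ 118 ∷ 212 ∷ 159 ∷ []) ∷
  (7 ∷ 194 ∷ 262 ∷ 246 ∷ []) ∷
  (9 ∷ 203 ∷ 224 ∷ 276 ∷ []) ∷
  (68 ∷ 74 ∷ 227 ∷ 174 ∷ []) ∷
  (4 ∷ 215 ∷ 250 ∷ 236 ∷ []) ∷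
  (14 ∷ 129 ∷ 254 ∷ 173 ∷ []) ∷
  (8 ∷ 192 ∷ 238 ∷ 273 ∷ []) ∷
  (65 ∷ 78 ∷ 225 ∷ 172 ∷ []) ∷
  (43 ∷ 126 ∷ 218 ∷ 154 ∷ []) ∷
  (17 ∷ 107 ∷ 167 ∷ 279 ∷ []) ∷
  (45 ∷ 75 ∷ 181 ∷ 247 ∷ []) ∷
  (41 ∷ 93 ∷ 146 ∷ 274 ∷ []) ∷
  (2 ∷ 198 ∷ 253 ∷ 249 ∷ []) ∷
  (59 ∷ 105 ∷ 205 ∷ 157 ∷ []) ∷
  (30 ∷ 86 ∷ 217 ∷ 169 ∷ []) ∷
  (58 ∷ 97 ∷ 136 ∷ 259 ∷ []) ∷
  (28 ∷ 104 ∷ 149 ∷ 235 ∷ []) ∷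
  (47 ∷ 85 ∷ 148 ∷ 261 ∷ []) ∷
  (25 ∷ 116 ∷ 143 ∷ 221 ∷ []) ∷
  (16 ∷ 121 ∷ 251 ∷ 177 ∷ []) ∷
  (13 ∷ 128 ∷ 163 ∷ 267 ∷ []) ∷
  (48 ∷ 98 ∷ 131 ∷ 272 ∷ []) ∷
  (21 ∷ 99 ∷ 209 ∷ 184 ∷ []) ∷
  (1 ∷ 208 ∷ 230 ∷ 269 ∷ []) ∷
  (63 ∷ 71 ∷ 162 ∷ 245 ∷ []) ∷
  (62 ∷ 92 ∷ 137 ∷ 252 ∷ []) ∷
  (22 ∷ 120 ∷ 147 ∷ 244 ∷ []) ∷
  (40 ∷ 76 ∷ 240 ∷ 188 ∷ []) ∷
  (42 ∷ 123 ∷ 210 ∷ 158 ∷ []) ∷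
  (64 ∷ 114 ∷ 211 ∷ 150 ∷ []) ∷
  (56 ∷ 119 ∷ 201 ∷ 151 ∷ []) ∷
  (20 ∷ 96 ∷ 216 ∷ 179 ∷ []) ∷
  (24 ∷ 95 ∷ 204 ∷ 171 ∷ []) ∷
  (49 ∷ 125 ∷ 197 ∷ 153 ∷ []) ∷
  (55 ∷ 77 ∷ 164 ∷ 232 ∷ []) ∷
  (67 ∷ 102 ∷ 207 ∷ 155 ∷ []) ∷
  (10 ∷ 112 ∷ 256 ∷ 182 ∷ []) ∷
  (29 ∷ 83 ∷ 202 ∷ 189 ∷ []) ∷
  (53 ∷ 110 ∷ 195 ∷ 156 ∷ []) ∷
  (31 ∷ 111 ∷ 132 ∷ 242 ∷ []) ∷
  (36 ∷ 90 ∷ 190 ∷ 176 ∷ []) ∷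
  (11 ∷ 124 ∷ 161 ∷ 271 ∷ []) ∷
  (18 ∷ 103 ∷ 263 ∷ 186 ∷ []) ∷
  (0 ∷ 214 ∷ 226 ∷ 266 ∷ []) ∷
  (37 ∷ 84 ∷ 213 ∷ 166 ∷ []) ∷
  (60 ∷ 113 ∷ 219 ∷ 152 ∷ []) ∷
  (57 ∷ 94 ∷ 130 ∷ 264 ∷ []) ∷
  (33 ∷ 81 ∷ 200 ∷ 178 ∷ []) ∷
  (50 ∷ 91 ∷ 133 ∷ 265 ∷ []) ∷
  (35 ∷ 80 ∷ 206 ∷ 183 ∷ []) ∷
  (51 ∷ 72 ∷ 223 ∷ 180 ∷ []) ∷
  (46 ∷ 87 ∷ 144 ∷ 260 ∷ []) ∷
  (61 ∷ 70 ∷ 170 ∷ 243 ∷ []) ∷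
  (52 ∷ 79 ∷ 165 ∷ 233 ∷ []) ∷
  (34 ∷ 101 ∷ 140 ∷ 237 ∷ []) ∷
  (32 ∷ 100 ∷ 145 ∷ 234 ∷ []) ∷ []

blank : Labelling
blank = Vec.replicate 9 0F

-- The labellings are passed as an argument so that the evaluator computes them only once.
coverOf : List Labelling → Cover
coverOf labellings = Vec.map (Vec.map (nthOr blank labellings)) cliqueIndices

cover : Cover
cover = coverOf canonicalLabellings

cliqueLabelling-coverOf : ∀ labellings m k →
  cliqueLabelling (coverOf labellings) m k ≡ nthOr blank labellings (lookup (lookup cliqueIndices m) k)
cliqueLabelling-coverOf labellings m k =
  trans (cong (λ row → lookup row k) (lookup-map m (Vec.map (nthOr blank labellings)) cliqueIndices))
        (lookup-map k (nthOr blank labellings) (lookup cliqueIndices m))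

open CliqueCover cover refl renaming (balanced to cover-balanced; clique to cover-clique)

cliqueIndices-exhaustive : ∀ (i : Fin (length canonicalLabellings)) →
  ∃₂ λ m k → lookup (lookup cliqueIndices m) k ≡ toℕ i
cliqueIndices-exhaustive = exhaustive?-sound cliqueIndices (length canonicalLabellings) refl

canonicalLabelling-inCover : ∀ {l} → l ∈ canonicalLabellings →
  ∃₂ λ m k → cliqueLabelling cover m k ≡ l
canonicalLabelling-inCover {l} l∈ =
  let i = Any.index l∈
      (m , k , mk↦i) = cliqueIndices-exhaustive i
  in m , k , (begin
    cliqueLabelling cover m k
      ≡⟨ cliqueLabelling-coverOf canonicalLabellings m k ⟩
    nthOr blank canonicalLabellings (lookup (lookup cliqueIndices m) k)
      ≡⟨ cong (nthOr blank canonicalLabellings) mk↦i ⟩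
    nthOr blank canonicalLabellings (toℕ i)
      ≡⟨ nthOr-lookup blank canonicalLabellings i ⟩
    List.lookup canonicalLabellings i
      ≡⟨ sym (lookup-index l∈) ⟩
    l ∎)

cover-complete : ∀ R → IsPartition333 R → ∃₂ λ m k → R ≡ partition (cliqueLabelling cover m k)
cover-complete R isP = inCover (canonicalLabelling R isP)
  where
  inCover : (∃ λ l → l ∈ canonicalLabellings × partition l ≡ R) →
    ∃₂ λ m k → R ≡ partition (cliqueLabelling cover m k)
  inCover (l , l∈ , partition-l) =
    let (m , k , mk↦l) = canonicalLabelling-inCover l∈
    in m , k , trans (sym partition-l) (cong partition (sym mk↦l))

certificateText : List String
certificateText =
  "b 69 b 65 b 55 b 48 b 10 b 62 b 58 b 61 b 61 b 51 b 58 b 50 b 47 b 46 b 44 b 41 b 45 b 46 b 50 b 50" ∷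
  "b 49 b 48 b 47 b 46 b 45 b 44 b 43 b 42 b 41 b 40 b 39 b 38 b 37 b 36 b 35 b 34 b 33 b 32 b 31 b 30" ∷
  "b 29 b 28 b 27 b 26 b 25 b 24 b 23 b 22 b 21 b 20 b 19 b 18 b 17 b 16 b 15 b 14 b 13 b 12 b 11 b 10" ∷
  "b 9 b 8 b 7 b 6 b 5 b 4 b 3 b 2 b 1 b 0 d 0 1 x 3 x 0 x 2 x 3 x 1 x 2 x 2 x 0 x 1 x 1 x 15 x 3 x 17" ∷
  "x 0 x 2 x 12 x 3 x 6 x 4 x 2 x 5 x 8 x 1 x 6 x 0 x 3 x 1 x 10 x 0 x 1 x 13 x 0 x 1 x 9 x 4 x 0 x 2" ∷
  "x 0 x 12 x 9 x 1 x 7 x 0 x 7 x 4 x 0 x 15 x 1 x 3 x 0 x 1 x 1 x 0 x 9 x 5 x 0 x 3 x 22 x 1 x 2 x 0" ∷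
  "x 4 x 1 x 0 x 1 x 2 x 8 x 5 x 1 x 14 x 0 x 1 x 6 x 2 x 7 x 5 x 15 x 0 x 0 x 2 x 3 x 1 x 0 x 2 x 8" ∷
  "x 0 x 1 x 2 x 1 x 0 x 3 x 0 x 5 x 0 x 3 x 4 x 6 x 0 x 5 x 0 x 8 x 10 x 0 x 7 x 1 x 7 x 0 x 3 x 2 x 6" ∷
  "x 0 x 3 x 22 x 2 x 1 x 6 x 19 x 12 x 2 x 0 x 1 x 0 x 13 x 1 x 4 x 0 x 2 x 15 x 6 x 4 x 2 x 0 x 3 x 1" ∷
  "x 10 x 11 x 1 x 2 x 7 x 0 x 9 x 1 x 7 x 2 x 2 x 4 x 1 x 5 x 8 x 0 x 5 x 0 x 3 x 2 x 1 x 0 x 0 x 12" ∷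
  "x 5 x 3 x 12 x 0 x 0 x 4 x 10 x 7 x 1 x 9 x 1 x 4 x 0 x 1 x 0 x 4 x 1 x 0 x 5 x 1 x 2 x 0 x 1 x 2" ∷
  "x 0 x 1 x 2 x 0 x 1 x 2 x 0 x 5 x 0 x 2 x 0 x 2 b 51 x 0 x 1 x 2 b 44 x 0 x 3 b 41 x 0 x 2 b 17 x 1" ∷
  "b 14 x 1 x 4 x 0 b 53 b 17 x 1 x 11 x 0 b 31 x 0 b 39 x 0 x 1 b 49 x 0 x 2 x 1 b 51 x 0 x 5 b 50 x 6" ∷
  "x 1 x 0 b 49 x 1 x 0 x 5 b 48 b 47 x 3 x 10 x 2 b 48 x 10 x 2 b 46 x 3 x 21 b 45 x 2 x 3 x 12 b 45" ∷
  "x 0 b 44 x 3 b 43 x 0 x 3 x 7 b 42 b 41 x 7 x 0 x 2 b 40 x 2 x 13 x 0 b 39 x 0 b 38 x 4 x 10 x 1" ∷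
  "b 37 x 0 b 36 x 2 b 35 x 5 b 34 x 5 b 33 x 2 b 32 b 31 x 2 b 30 x 4 x 7 b 29 b 28 x 2 x 0 b 27 x 3" ∷
  "x 0 b 26 x 0 x 1 b 25 x 1 x 4 x 9 b 24 b 23 x 1 x 0 b 22 x 0 x 7 b 21 x 5 b 20 x 7 b 19 x 2 x 7 b 18" ∷
  "x 1 b 17 b 16 x 1 x 13 b 15 x 0 x 1 b 14 b 13 x 12 x 2 x 0 b 12 b 11 x 8 b 10 x 0 x 12 b 9 x 0 x 7" ∷
  "b 8 x 7 b 7 b 6 b 5 x 2 b 4 b 3 b 2 x 2 b 1 b 0 d 4 6 x 3 x 0 x 2 x 14 x 0 x 2 x 0 x 1 x 7 x 4 x 3" ∷
  "x 5 x 1 x 0 x 25 x 4 x 1 x 8 x 2 x 5 x 3 x 0 x 0 x 15 x 2 x 1 x 9 x 0 x 0 x 4 x 2 x 6 x 8 x 0 x 4" ∷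
  "x 4 x 12 x 9 x 0 x 2 x 4 x 9 x 1 x 11 x 0 x 1 x 1 x 11 x 0 x 9 x 4 x 15 x 4 x 3 x 13 x 2 x 6 x 3 x 0" ∷
  "x 1 x 5 x 0 x 2 x 0 x 1 x 0 x 2 x 3 x 9 x 8 x 7 x 5 x 1 x 6 x 10 x 3 x 13 x 1 x 13 x 0 x 8 x 3 x 1" ∷
  "x 0 x 1 x 2 x 10 x 4 x 4 x 1 x 3 x 10 b 40 b 37 x 2 x 1 x 0 b 54 x 2 x 0 x 5 b 48 x 1 x 2 b 44 b 45" ∷
  "b 41 x 8 x 0 x 1 b 40 x 0 x 1 b 38 x 1 x 2 b 40 b 37 x 1 x 5 b 36 x 4 b 34 x 4 b 32 b 31 b 29 x 3" ∷
  "x 9 x 4 b 24 b 21 x 10 b 17 x 5 x 7 b 15 b 14 x 7 x 0 b 13 b 12 b 11 x 4 b 10 x 0 x 9 b 9 x 0 x 10" ∷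
  "b 4 b 1 x 6 x 5 b 29 x 0 b 27 x 3 b 27 x 2 x 16 b 7 x 2 x 4 x 11 x 0 x 0 x 0 x 7 b 26 x 0 b 25 x 2" ∷
  "x 1 x 11 x 0 x 5 x 1 x 2 x 0 x 1 x 8 x 0 x 2 x 1 x 2 x 0 x 10 x 0 x 3 x 0 x 1 x 4 x 8 x 3 x 2 x 1" ∷
  "x 1 x 2 x 0 x 6 x 0 x 8 x 0 x 1 x 2 x 0 x 1 x 2 x 2 x 1 x 1 x 6 x 6 x 1 x 2 x 0 x 3 x 7 x 2 x 6 x 0" ∷
  "x 7 x 2 x 0 x 0 x 1 x 11 x 0 x 0 x 5 x 0 x 3 x 2 x 2 x 0 x 1 x 1 x 0 x 2 x 1 b 53 x 0 x 2 x 1 b 48" ∷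
  "x 1 x 0 b 62 b 63 x 1 b 59 b 58 x 1 x 7 x 2 b 59 x 0 x 3 x 1 b 57 x 0 x 5 x 6 b 54 x 0 x 10 x 1 b 34" ∷
  "x 7 x 10 x 0 x 6 x 4 x 5 x 0 x 0 x 3 x 1 x 3 x 0 x 3 x 0 x 0 b 61 x 0 x 1 b 53 x 0 x 2 b 61 x 0 x 2" ∷
  "b 57 x 1 x 3 b 56 x 0 x 5 b 59 x 3 b 60 x 3 b 54 b 58 x 1 x 3 x 0 b 56 x 4 b 57 b 52 x 4 x 2 x 0 x 7" ∷
  "x 7 x 0 x 10 x 0 x 7 x 7 x 3 x 5 x 0 x 6 x 2 x 0 x 2 x 0 x 1 x 1 b 46 x 1 x 2 x 0 b 9 x 2 x 0 b 60" ∷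
  "x 0 x 2 b 56 x 1 x 2 b 53 x 3 x 2 x 0 b 51 b 48 x 5 x 2 b 59 b 57 b 57 x 6 x 0 b 56 x 8 x 0 x 7 b 54" ∷
  "x 0 b 52 x 5 x 0 x 1 b 52 x 1 b 51 x 4 x 1 b 49 b 48 b 47 x 4 x 6 x 0 b 46 x 18 b 46 b 45 x 2 x 4" ∷
  "x 10 b 44 x 9 b 43 b 43 x 2 b 42 x 2 x 3 b 41 x 1 b 40 x 1 x 3 b 39 x 0 x 6 x 4 b 38 x 7 b 37 b 36" ∷
  "x 2 b 35 x 0 x 18 x 1 b 34 b 33 b 32 x 8 b 31 x 6 b 30 x 15 x 3 x 1 b 29 b 28 b 27 x 3 x 1 x 0 b 26" ∷
  "x 3 x 1 x 2 b 25 x 4 b 24 x 1 x 12 b 23 x 0 b 22 b 21 x 1 x 0 x 6 b 20 x 0 x 7 b 19 x 0 x 1 b 18" ∷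
  "b 17 b 16 x 4 b 15 x 4 b 14 b 13 x 2 b 12 b 11 x 4 b 10 x 0 x 22 b 9 x 5 b 8 b 7 x 5 b 6 x 9 x 8 b 5" ∷
  "x 0 x 12 b 4 b 3 x 11 x 4 b 2 x 4 x 17 b 1 x 3 b 0 x 0 x 3 x 1 d 4 8 x 5 x 0 x 0 x 1 x 5 x 4 x 1 x 4" ∷
  "x 4 x 1 x 6 x 5 x 2 x 0 x 0 x 12 x 1 x 1 x 0 x 4 x 1 x 0 x 13 x 1 x 2 x 5 x 0 x 32 x 1 x 0 x 1 x 3" ∷
  "x 0 x 6 x 2 x 14 x 1 x 2 x 1 x 1 x 5 x 2 x 7 x 3 x 2 x 5 x 2 x 6 x 0 x 4 x 5 x 4 x 20 x 8 x 3 x 0" ∷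
  "x 15 x 0 x 2 x 1 x 1 x 3 x 5 x 5 x 0 x 1 x 0 x 9 x 4 x 0 x 13 x 3 x 2 x 1 x 1 x 0 x 1 x 4 x 18 x 6" ∷
  "x 1 x 3 x 1 x 0 x 2 x 8 x 8 x 5 x 1 x 9 x 7 x 1 x 0 x 0 x 4 x 3 x 1 x 1 x 7 x 0 x 2 x 1 x 0 x 5 x 0" ∷
  "x 3 x 0 x 4 x 0 b 56 x 1 x 2 x 0 b 53 x 3 x 0 b 51 x 0 x 1 b 40 x 3 x 1 x 0 b 29 x 0 x 4 b 54 b 41" ∷
  "b 20 b 47 b 35 b 16 b 9 b 5 b 0 b 49 b 42 x 14 b 3 x 0 x 1 x 3 x 11 x 3 x 0 b 21 x 10 b 45 x 13 b 41" ∷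
  "x 1 b 39 x 0 x 7 b 40 x 0 x 8 b 41 x 0 b 41 x 4 x 1 x 0 b 39 x 5 x 0 b 40 x 0 b 38 x 23 b 37 x 3" ∷
  "x 11 b 36 x 7 b 35 x 10 x 1 b 34 x 6 x 0 b 34 x 2 x 15 b 33 x 3 x 7 b 32 x 2 x 3 b 31 x 0 b 30 x 1" ∷
  "x 3 x 0 b 29 x 4 b 28 x 0 b 27 x 10 x 1 x 0 b 26 x 0 x 6 x 2 b 25 x 4 b 24 x 3 x 9 x 5 b 23 x 4 x 5" ∷
  "x 1 b 22 x 4 x 9 x 0 b 21 x 19 x 0 b 20 x 0 x 7 b 19 x 8 x 1 x 0 b 18 x 6 b 17 x 1 b 16 x 1 b 15 x 3" ∷
  "x 1 b 14 x 1 b 13 x 6 x 0 b 12 x 10 x 0 x 6 b 11 x 7 x 3 b 10 x 1 b 9 x 1 b 8 x 2 b 7 x 0 b 6 x 14" ∷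
  "x 18 x 1 b 5 x 4 x 14 x 0 b 4 x 6 b 3 x 3 b 2 x 2 x 1 b 1 x 5 x 3 b 0 x 8 x 4 d 1 7 x 0 x 0 x 0 x 1" ∷
  "x 4 x 0 x 3 x 3 x 10 x 1 x 12 x 4 x 0 x 2 x 6 x 1 x 15 x 2 x 7 x 8 x 3 x 17 x 8 x 6 x 1 x 7 x 4 x 9" ∷
  "x 7 x 11 x 14 x 1 x 3 x 1 x 12 x 6 x 8 x 1 x 0 x 1 x 2 x 2 x 8 x 0 x 5 x 3 x 6 x 5 x 6 x 6 x 4 x 1" ∷
  "x 1 x 2 x 0 x 3 x 0 x 2 x 0 x 1 x 12 x 6 x 3 x 0 x 2 x 0 x 4 x 0 x 1 x 2 x 2 x 1 x 0 x 2 x 14 x 0" ∷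
  "x 1 x 2 x 0 x 0 x 1 x 12 x 1 x 11 x 0 x 0 x 10 b 51 x 0 x 11 b 52 x 0 b 55 b 48 x 4 x 2 x 0 b 52 x 0" ∷
  "x 3 x 1 b 45 x 0 x 6 x 2 b 49 x 4 x 2 x 0 b 48 x 7 x 1 b 46 b 45 x 1 x 0 b 44 x 3 b 36 x 7 x 13 x 22" ∷
  "x 0 x 2 x 21 x 6 x 5 x 2 x 0 x 4 x 2 x 0 x 6 x 1 x 3 x 1 x 2 x 4 x 1 x 1 b 61 b 55 x 1 x 2 x 0 b 45" ∷
  "b 52 b 35 x 4 x 0 x 2 b 31 x 3 x 4 x 0 b 29 x 1 x 3 x 0 b 20 x 0 x 2 x 4 b 59 b 57 b 47 b 56 b 54" ∷
  "b 44 b 42 b 35 b 29 b 50 b 48 b 46 b 45 b 44 x 13 x 1 x 0 x 8 x 13 x 0 x 4 x 0 x 12 x 1 x 10 x 5 x 0" ∷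
  "x 2 b 47 x 12 b 20 x 0 x 1 x 2 x 13 x 0 x 3 x 10 x 0 x 2 x 4 x 0 x 1 x 3 x 1 x 4 x 0 x 0 x 2 x 1 x 2" ∷
  "x 0 x 1 x 0 b 54 x 0 x 2 b 54 b 44 x 1 x 4 x 3 x 0 x 1 x 0 x 6 x 1 x 2 x 3 x 1 x 0 b 53 x 0 x 2 x 1" ∷
  "b 56 x 1 b 51 b 54 x 2 b 50 x 3 x 7 x 1 b 49 x 7 x 0 b 50 x 0 x 5 x 7 b 48 b 47 x 4 x 11 x 1 b 48" ∷
  "b 47 x 6 x 1 x 4 b 44 x 0 x 1 x 12 b 45 b 44 x 6 x 0 b 43 x 3 b 42 x 3 x 5 x 1 b 41 b 40 x 8 x 1 x 5" ∷
  "b 39 x 0 x 1 x 7 b 38 x 7 x 0 x 3 b 37 x 0 b 36 b 35 x 3 x 12 x 9 b 34 x 2 b 33 x 10 x 2 x 0 b 32" ∷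
  "b 31 x 1 x 0 x 11 b 30 x 2 x 5 b 29 b 28 b 27 b 26 x 7 x 0 x 1 b 25 x 9 x 3 b 24 x 1 x 4 x 0 b 23" ∷
  "x 2 b 22 x 1 x 3 x 5 b 21 x 0 x 4 x 3 b 20 x 0 b 19 x 5 x 1 b 18 x 0 x 2 b 17 x 1 b 16 x 14 x 1 x 7" ∷
  "b 15 x 6 x 5 b 14 x 1 x 4 x 3 b 13 x 1 x 0 x 9 b 12 x 2 x 0 x 5 b 11 b 10 x 6 b 9 b 8 x 4 x 0 b 7" ∷
  "x 0 x 4 x 1 b 6 x 5 x 6 x 0 b 5 b 4 x 1 x 14 x 0 b 3 x 3 x 1 x 0 b 2 x 3 x 1 b 1 b 0 d 2 3 x 10 x 0" ∷
  "x 3 x 2 x 12 x 0 x 14 x 2 x 3 x 1 x 1 x 6 x 1 x 0 x 12 x 0 x 0 x 3 x 11 x 2 x 4 x 2 x 8 x 17 x 3 x 2" ∷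
  "x 1 x 4 x 1 x 0 x 8 x 9 x 2 x 0 x 1 x 8 x 0 x 4 x 6 x 8 x 7 x 1 x 19 x 0 x 1 x 4 x 14 x 16 x 15 x 2" ∷
  "x 0 x 6 x 7 x 6 x 9 x 4 x 0 x 6 x 1 x 0 x 9 x 8 x 2 x 5 x 1 x 0 x 1 x 3 x 5 x 2 x 0 x 2 x 0 x 5 x 0" ∷
  "b 57 x 0 b 33 x 4 b 50 x 0 b 42 x 0 b 46 x 1 b 39 x 0 b 40 x 6 x 4 b 51 x 4 b 50 x 1 b 37 x 1 x 2" ∷
  "b 36 x 6 b 35 x 1 b 33 x 1 b 32 x 7 x 18 b 25 x 4 b 23 x 4 b 22 x 4 b 20 x 2 b 17 x 5 b 14 x 0 b 12" ∷
  "x 1 b 10 x 2 b 9 x 1 x 8 b 8 x 9 b 7 x 4 b 6 x 6 x 1 b 2 x 1 b 1 x 1 b 0 x 0 x 4 b 29 x 0 b 28 x 4" ∷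
  "b 6 x 16 x 1 x 4 x 0 x 2 x 0 b 25 x 0 x 5 x 1 b 26 x 4 x 2 x 0 b 23 x 15 x 6 x 0 x 2 x 7 x 17 x 0" ∷
  "x 6 x 2 x 5 x 2 x 2 x 0 x 0 x 1 x 0 x 5 x 6 x 0 x 5 x 16 x 2 x 9 x 0 x 0 x 1 x 7 x 1 x 7 x 2 x 0 x 3" ∷
  "x 0 x 3 x 0 x 8 x 2 x 1 x 5 x 7 x 2 x 0 x 0 x 3 x 0 x 7 x 3 x 8 x 0 x 1 x 6 x 4 x 1 x 0 x 1 b 54 x 1" ∷
  "b 45 x 1 b 52 b 42 x 3 x 7 b 41 x 2 x 6 x 1 b 45 x 6 x 0 x 3 b 51 b 49 x 2 b 47 x 0 x 1 x 6 b 46" ∷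
  "b 45 x 1 b 43 x 0 x 7 x 1 b 45 x 3 x 0 b 42 b 43 x 3 b 42 b 41 b 40 b 39 x 5 b 38 x 7 x 2 b 37 x 21" ∷
  "x 2 x 10 b 36 x 1 x 5 x 3 b 35 x 2 b 34 x 10 x 1 x 0 b 33 x 0 b 32 x 0 x 18 b 31 x 5 b 30 x 0 x 1" ∷
  "x 5 b 29 x 5 b 28 x 2 b 27 x 0 x 5 x 7 b 26 x 2 b 25 x 7 b 24 x 8 b 23 b 22 x 3 x 4 b 21 b 20 x 4" ∷
  "x 0 b 19 x 2 b 18 b 17 b 16 x 3 x 0 b 15 x 0 x 2 x 4 b 14 b 13 b 12 b 11 x 3 b 10 b 9 x 6 x 22 b 8" ∷
  "x 6 b 7 x 19 x 2 b 6 x 0 x 1 b 5 x 0 b 4 x 2 b 3 b 2 x 2 x 9 x 0 b 1 x 4 x 0 x 1 b 0 x 5 x 7 d 3 5" ∷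
  "x 0 x 3 x 4 x 0 x 19 x 0 x 4 x 7 x 2 x 0 x 0 x 9 x 1 x 4 x 2 x 10 x 0 x 1 x 8 x 3 x 0 x 1 x 0 x 8" ∷
  "x 0 x 2 x 6 x 1 x 3 x 0 x 13 x 0 x 10 x 7 x 10 x 0 x 3 x 3 x 1 x 6 x 2 x 6 x 2 x 3 x 1 x 2 x 3 x 17" ∷
  "x 9 x 1 x 7 x 3 x 1 x 0 x 0 x 3 x 5 x 3 x 4 x 8 x 0 x 0 x 6 x 0 x 4 x 1 x 13 x 3 x 0 x 5 x 16 x 8" ∷
  "x 0 x 1 x 0 x 1 x 0 x 2 x 4 x 0 x 3 x 12 x 6 x 0 x 0 x 6 x 0 x 2 x 1 x 1 x 2 x 0 x 1 x 2 x 0 x 2 x 0" ∷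
  "x 5 b 58 x 0 b 43 b 56 x 1 x 0 b 51 x 6 b 22 x 1 x 2 x 4 x 0 x 0 x 1 x 7 x 1 x 0 x 4 b 3 x 1 x 4 b 0" ∷
  "x 1 x 3 x 0 b 55 b 53 x 2 x 0 b 53 b 45 x 6 x 4 b 51 b 49 x 3 x 0 b 47 x 4 x 11 b 48 x 0 x 11 b 47" ∷
  "x 0 b 46 x 11 x 7 x 1 b 45 x 1 b 44 x 5 x 1 b 43 b 42 x 2 x 12 b 41 x 2 x 4 b 40 b 39 x 2 x 6 b 38" ∷
  "x 6 b 37 b 36 b 35 b 34 x 10 b 33 b 32 b 31 x 10 x 3 b 30 x 7 x 10 x 1 b 29 x 4 x 5 b 28 b 27 x 3" ∷
  "x 0 b 26 x 12 x 0 x 6 b 25 x 26 x 1 b 24 x 0 x 1 b 23 x 0 x 5 x 13 b 22 b 21 x 5 x 1 x 0 b 20 x 8" ∷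
  "b 19 x 3 x 1 b 18 b 17 b 16 x 2 x 3 x 0 b 15 x 8 x 0 b 14 x 1 b 13 x 1 b 12 x 8 b 11 x 9 b 10 x 9" ∷
  "b 9 x 0 x 12 b 8 x 4 x 9 x 0 b 7 x 1 x 3 x 13 b 6 x 0 x 1 x 3 b 5 x 2 b 4 b 3 x 1 x 13 b 2 b 1 x 3" ∷
  "b 0 x 2 d 2 5 x 0 x 1 x 17 x 0 x 6 x 1 x 7 x 4 x 9 x 1 x 5 x 0 x 1 x 19 x 1 x 3 x 6 x 0 x 19 x 0 x 5" ∷
  "x 0 x 9 x 0 x 1 x 4 x 2 x 10 x 7 x 0 x 9 x 2 x 2 x 1 x 2 x 11 x 1 x 9 x 0 x 2 x 7 x 1 x 4 x 0 x 0" ∷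
  "x 4 x 9 x 1 x 1 x 0 x 5 x 1 x 0 x 4 x 1 x 0 x 6 x 4 x 2 x 5 x 0 x 1 x 10 x 3 x 0 x 1 x 5 x 3 x 8 x 1" ∷
  "x 2 x 0 x 6 x 0 x 5 x 6 x 13 x 5 x 3 x 0 x 2 x 1 x 8 x 0 x 1 x 1 x 0 x 7 x 9 x 0 b 49 b 53 b 52 x 4" ∷
  "x 1 b 51 b 49 x 1 x 0 x 4 x 2 x 1 x 8 x 3 x 11 x 2 x 0 x 7 x 0 x 6 x 4 x 8 x 0 x 2 x 3 x 1 x 0 x 1" ∷
  "x 0 x 3 x 1 b 29 x 1 x 2 b 63 x 0 b 52 x 1 x 3 b 61 x 0 b 58 x 2 x 5 b 58 b 55 b 57 x 2 b 55 x 0" ∷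
  "b 54 b 53 x 11 x 4 b 55 x 2 b 52 x 3 x 9 x 6 b 53 x 4 x 0 x 3 b 52 x 1 x 3 x 0 b 51 x 0 b 50 b 49" ∷
  "b 48 x 3 x 4 x 1 b 47 x 3 x 5 b 46 x 1 x 2 b 45 b 44 b 43 x 14 b 42 x 5 x 2 x 0 b 41 x 6 x 0 x 5" ∷
  "b 40 x 0 x 12 x 3 b 39 b 38 x 3 b 37 x 3 x 2 x 0 b 36 x 0 x 2 x 3 b 35 x 1 x 8 b 34 x 5 x 9 x 1 b 33" ∷
  "x 0 b 32 x 0 x 2 b 31 x 6 x 9 x 0 b 30 b 29 x 3 b 28 x 0 b 27 b 26 b 25 b 24 x 16 b 23 x 5 b 22 x 1" ∷
  "x 9 b 21 x 7 b 20 b 19 x 9 x 5 x 0 b 18 x 3 x 1 x 7 b 17 b 16 x 1 x 0 b 15 x 0 b 14 b 13 b 12 x 6" ∷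
  "b 11 x 0 x 7 b 10 x 4 x 5 x 0 b 9 x 1 x 5 b 8 x 7 x 1 x 0 b 7 x 2 x 8 x 0 b 6 x 9 b 5 b 4 b 3 x 3" ∷
  "x 1 x 15 b 2 b 1 x 14 x 3 b 0 x 9 x 3 d 6 8 x 4 x 2 x 2 x 19 x 1 x 6 x 0 x 4 x 24 x 0 x 1 x 0 x 2" ∷
  "x 3 x 1 x 3 x 0 x 5 x 0 x 1 x 1 x 2 x 0 x 6 x 4 x 3 x 0 x 8 x 3 x 2 x 0 x 5 x 0 x 2 x 2 x 4 x 1 x 0" ∷
  "x 1 x 6 x 4 x 12 x 14 x 1 x 0 x 8 x 3 x 1 x 9 x 1 x 13 x 0 x 1 x 3 x 20 x 10 x 1 x 4 x 3 x 4 x 15" ∷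
  "x 1 x 4 x 3 x 4 x 2 x 0 x 7 x 4 x 4 x 9 x 3 x 4 x 7 x 0 x 3 x 9 x 16 x 8 x 4 x 2 x 3 x 5 x 0 x 0 x 9" ∷
  "x 1 x 5 x 1 x 6 x 0 x 5 x 8 x 4 x 1 x 2 x 7 x 0 x 1 x 2 x 1 x 0 b 60 b 58 x 2 x 0 x 1 b 57 x 3 x 2" ∷
  "b 54 x 3 x 2 x 0 b 60 x 4 x 0 x 3 b 54 x 1 x 0 x 4 b 57 x 4 x 0 x 5 b 56 x 1 x 0 b 54 x 0 x 4 x 1" ∷
  "b 54 x 2 x 3 x 0 b 54 x 1 x 3 x 0 b 52 x 0 x 4 x 1 b 51 x 6 b 50 x 8 x 7 x 1 b 49 x 4 x 8 x 2 b 48" ∷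
  "x 3 x 1 x 0 b 47 x 3 x 1 b 46 x 1 b 46 b 45 x 11 x 13 b 44 x 2 b 43 b 42 x 1 b 41 x 7 b 40 x 3 x 2" ∷
  "b 39 x 0 x 22 x 3 b 38 x 10 b 37 b 36 x 2 x 10 b 35 x 2 x 12 x 1 b 34 x 1 b 33 x 8 b 32 x 0 x 12 x 2" ∷
  "b 31 x 2 b 30 x 14 x 12 b 29 x 0 x 5 x 9 b 28 x 2 b 27 x 3 x 1 x 11 b 26 x 12 x 21 x 1 b 25 x 1 x 11" ∷
  "b 24 x 0 x 1 x 6 b 23 x 8 x 1 x 2 b 22 x 0 x 1 b 21 b 20 x 2 x 5 x 12 b 19 x 13 x 16 x 6 b 18 x 3" ∷
  "b 17 b 16 x 12 x 0 b 15 x 0 x 11 x 2 b 14 x 8 x 0 x 2 b 13 x 9 x 0 x 3 b 12 x 6 x 0 x 3 b 11 x 3 x 0" ∷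
  "b 10 b 9 x 1 x 11 x 2 b 8 x 0 x 15 b 7 x 0 x 2 b 6 x 0 x 6 x 14 b 5 b 4 x 1 x 6 x 0 b 3 x 9 x 1 x 0" ∷
  "b 2 x 3 x 1 x 19 b 1 x 5 x 0 x 12 b 0 d 0 7 x 13 x 7 x 0 x 2 x 4 x 5 x 1 x 3 x 4 x 0 x 20 x 5 x 13" ∷
  "x 1 x 5 x 15 x 9 x 6 x 7 x 0 x 11 x 10 x 12 x 9 x 0 x 3 x 1 x 0 x 6 x 0 x 3 x 5 x 0 x 1 x 0 x 7 x 5" ∷
  "x 0 x 4 x 2 x 0 x 8 x 0 x 2 x 5 x 8 x 16 x 1 x 7 x 4 x 2 x 0 x 11 x 4 x 15 x 2 x 4 x 3 x 4 x 1 x 4" ∷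
  "x 0 x 2 x 0 x 0 b 68 b 65 b 63 b 49 b 47 b 21 x 5 x 3 x 0 b 62 b 61 b 50 b 49 b 38 b 31 b 54 x 6" ∷
  "b 49 x 7 b 46 x 0 x 3 x 12 b 19 x 1 x 9 x 0 x 4 x 0 x 3 x 0 b 48 x 0 b 50 x 1 x 4 b 45 x 1 x 0 b 44" ∷
  "x 3 x 10 x 4 b 46 x 1 x 0 b 44 b 43 b 45 b 44 x 3 b 43 x 0 x 6 b 42 x 1 x 3 x 5 b 39 x 2 b 33 b 30" ∷
  "b 29 b 28 b 27 b 26 b 24 x 7 x 13 x 1 b 22 x 0 x 9 x 3 b 21 x 0 x 15 x 3 b 20 x 1 x 0 b 17 x 1 b 15" ∷
  "x 3 x 1 b 13 x 0 x 3 b 12 x 1 x 5 x 7 b 29 x 0 x 10 b 26 b 9 x 1 x 0 x 2 x 9 x 0 x 5 x 9 b 27 x 0" ∷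
  "x 1 x 2 b 15 x 0 x 3 x 1 x 5 x 2 x 12 x 2 x 10 x 3 x 0 x 2 x 3 x 1 x 0 x 2 x 8 x 0 x 1 x 6 x 1 x 0" ∷
  "x 0 x 6 x 2 x 5 x 6 x 0 x 8 x 1 x 1 x 1 x 7 x 0 x 1 x 10 x 0 x 6 x 7 x 7 x 2 x 0 x 7 x 6 x 0 x 1" ∷
  "x 11 x 0 x 1 x 2 x 4 x 1 x 0 x 0 x 2 x 1 x 0 x 3 x 4 x 0 x 2 x 3 b 61 x 0 b 55 x 2 x 5 b 44 x 0 x 3" ∷
  "x 5 x 1 x 0 x 2 x 3 x 2 x 1 x 1 x 3 x 0 x 0 x 2 x 3 x 1 b 58 x 3 x 2 b 56 x 4 x 1 b 57 x 2 b 56 x 1" ∷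
  "x 0 b 59 b 58 x 2 x 0 x 6 b 57 x 5 x 4 b 57 x 0 x 3 x 1 b 56 x 1 b 55 x 7 b 54 x 0 x 3 x 1 b 54 x 4" ∷
  "x 0 b 53 x 4 b 52 b 51 b 50 x 5 x 0 b 49 x 4 b 48 b 47 b 46 x 10 x 3 b 45 x 10 x 2 x 18 b 44 x 15" ∷
  "b 43 b 42 b 41 b 40 b 39 b 38 x 10 x 4 b 37 x 12 x 2 x 13 b 36 x 7 b 35 b 34 x 2 x 0 b 33 x 3 x 4" ∷
  "b 32 x 3 x 1 x 0 b 31 x 4 x 1 b 30 x 0 b 29 x 0 x 4 b 28 x 0 x 5 x 11 b 27 b 26 b 25 x 5 x 3 b 24" ∷
  "x 0 x 13 b 23 x 6 x 1 b 22 x 8 x 2 b 21 x 6 x 12 x 0 b 20 x 25 x 0 b 19 x 3 x 1 b 18 x 0 b 17 x 1" ∷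
  "x 5 x 6 b 16 b 15 b 14 b 13 b 12 x 7 b 11 x 0 x 5 b 10 x 22 x 13 x 0 b 9 x 1 b 8 x 9 x 1 x 3 b 7 x 2" ∷
  "b 6 x 2 b 5 x 1 b 4 x 4 x 6 b 3 x 4 x 2 b 2 x 1 b 1 b 0 x 6 d 3 7 x 0 x 8 x 12 x 0 x 1 x 13 x 0 x 5" ∷
  "x 0 x 0 x 4 x 1 x 5 x 0 x 7 x 29 x 3 x 1 x 14 x 0 x 2 x 0 x 6 x 3 x 1 x 12 x 0 x 2 x 10 x 7 x 0 x 6" ∷
  "x 7 x 6 x 16 x 5 x 7 x 8 x 1 x 2 x 7 x 2 x 0 x 9 x 4 x 2 x 5 x 4 x 2 x 13 x 5 x 12 x 3 x 0 x 2 x 4" ∷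
  "x 3 x 2 x 1 x 4 x 6 x 9 x 1 x 0 x 5 x 1 x 0 x 5 x 7 x 3 x 1 x 0 x 2 x 0 x 8 x 0 x 4 x 1 x 11 x 6 x 3" ∷
  "x 0 x 1 x 3 x 6 x 7 x 15 x 10 x 5 x 0 x 6 x 7 x 0 x 6 x 6 x 1 x 0 x 3 x 1 x 5 x 4 x 0 x 6 x 0 x 3" ∷
  "x 3 x 0 x 2 x 0 x 1 b 33 x 2 x 0 b 16 x 1 x 3 x 2 b 61 b 59 x 5 b 54 x 2 b 51 b 52 x 5 b 56 x 0 x 5" ∷
  "x 1 b 53 x 3 x 5 b 50 b 56 b 55 b 52 x 7 x 10 b 49 x 0 x 5 x 12 b 50 x 5 b 48 x 7 x 6 b 47 b 45 b 43" ∷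
  "x 3 b 45 x 4 x 2 b 46 x 0 x 2 x 7 b 45 x 0 x 1 x 2 b 44 x 2 b 43 x 4 x 3 b 42 x 16 b 41 x 2 b 40 x 5" ∷
  "b 39 x 4 x 6 b 38 x 0 x 12 b 37 b 36 x 22 b 35 x 15 b 34 x 0 x 11 b 33 x 2 x 1 b 32 x 8 b 31 b 30" ∷
  "x 2 x 3 x 0 b 29 x 2 b 28 x 0 b 27 x 1 x 2 x 12 b 26 x 3 x 10 b 25 x 0 x 2 x 6 b 24 x 10 x 6 b 23" ∷
  "x 0 x 1 b 22 x 6 x 1 x 2 b 21 x 0 x 2 b 20 x 6 b 19 x 2 x 5 x 0 b 18 x 10 b 17 x 3 x 0 b 16 x 9 b 15" ∷
  "x 3 b 14 x 1 b 13 x 3 b 12 x 3 x 9 x 1 b 11 x 9 x 0 x 5 b 10 x 4 x 0 b 9 x 0 x 1 x 2 b 8 x 0 b 7 x 6" ∷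
  "x 4 b 6 x 0 x 1 b 5 x 0 b 4 x 2 x 10 b 3 x 6 x 3 x 4 b 2 x 1 b 1 x 4 b 0 x 0 x 7 x 8 d 1 6 x 0 x 8" ∷
  "x 5 x 8 x 0 x 11 x 10 x 4 x 0 x 5 x 3 x 6 x 4 x 0 x 2 x 0 x 5 x 1 x 1 x 3 x 6 x 6 x 11 x 0 x 7 x 4" ∷
  "x 3 x 1 x 2 x 1 x 9 x 1 x 4 x 1 x 0 x 4 x 1 x 7 x 5 x 1 x 0 x 3 x 3 x 6 x 0 x 4 x 2 x 3 x 3 x 7 x 0" ∷
  "x 0 x 1 x 14 x 9 x 1 x 5 x 9 x 0 x 1 x 5 x 4 x 1 x 0 x 2 x 6 x 1 x 0 x 0 x 1 x 0 x 0 x 3 x 5 x 0 x 7" ∷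
  "x 4 x 3 x 1 x 0 x 1 x 0 x 2 x 5 x 2 x 6 x 0 x 1 x 1 x 3 x 3 x 0 x 2 x 1 b 63 b 56 x 2 b 51 x 0 b 49" ∷
  "x 0 x 2 b 58 x 4 x 0 x 1 b 51 x 2 x 0 x 4 b 58 x 1 x 0 x 2 b 60 b 58 b 58 b 53 x 4 b 55 x 4 x 0 x 3" ∷
  "b 55 b 54 x 9 x 0 b 52 x 9 x 1 b 52 x 10 x 4 x 0 b 50 x 1 b 49 x 1 b 48 x 1 x 9 b 47 b 46 x 2 b 45" ∷
  "x 0 x 12 b 44 x 1 x 0 b 42 x 1 b 43 x 13 b 42 x 8 b 41 b 40 x 2 x 4 b 39 x 5 x 0 b 38 b 37 x 7 x 3" ∷
  "b 36 x 6 x 12 x 1 b 35 x 1 b 34 x 7 x 4 b 33 x 10 b 32 x 2 x 1 b 31 b 30 x 4 x 1 b 29 b 28 b 27 x 2" ∷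
  "x 0 b 26 x 0 x 7 b 25 b 24 x 7 x 12 x 0 b 23 x 2 b 22 b 21 x 17 x 0 x 1 b 20 b 19 x 6 x 1 x 0 b 18" ∷
  "x 5 x 1 b 17 x 3 x 1 b 16 b 15 x 1 x 0 b 14 x 9 b 13 x 1 x 2 b 12 x 2 x 9 x 1 b 11 b 10 b 9 x 13 b 8" ∷
  "b 7 x 6 x 2 b 6 x 0 x 20 x 4 b 5 x 3 x 7 x 4 b 4 x 1 x 0 b 3 b 2 x 1 b 1 x 5 x 4 x 0 b 0 d 3 8 x 10" ∷
  "x 11 x 0 x 0 x 20 x 3 x 2 x 5 x 11 x 8 x 11 x 5 x 2 x 1 x 6 x 20 x 21 x 0 x 0 x 1 x 4 x 0 x 1 x 7" ∷
  "x 2 x 1 x 4 x 0 x 8 x 9 x 0 x 1 x 8 x 1 x 3 x 2 x 5 x 1 x 12 x 0 x 1 x 1 x 3 x 3 x 0 x 2 x 4 x 3 x 1" ∷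
  "x 0 x 0 x 1 x 3 x 3 x 2 x 9 x 0 x 7 x 8 x 0 x 10 x 3 x 2 x 2 x 0 x 6 x 3 x 1 x 0 x 1 x 3 x 0 x 4" ∷
  "x 14 x 5 x 4 x 5 x 0 x 5 x 9 x 1 x 4 x 4 x 3 x 4 x 3 x 3 x 3 x 0 x 3 x 9 x 3 x 2 x 1 x 0 x 8 x 0 x 2" ∷
  "x 3 x 0 x 1 x 5 x 1 x 3 x 2 x 1 x 0 b 49 x 1 b 60 x 2 b 50 x 0 b 54 x 2 b 30 x 0 b 27 x 1 b 6 x 2" ∷
  "b 59 b 58 x 1 x 0 b 57 x 0 x 1 x 4 b 54 b 44 x 2 b 46 x 0 b 44 x 0 x 2 b 50 x 4 x 0 x 2 b 42 x 3" ∷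
  "b 40 x 0 b 36 x 4 b 38 x 0 b 35 x 14 x 5 x 0 b 34 x 0 x 5 b 42 x 0 b 33 x 0 x 8 b 32 x 2 b 31 x 7" ∷
  "b 29 x 1 b 28 b 26 x 1 b 15 x 5 x 13 b 13 x 5 x 0 b 12 x 0 x 3 b 11 x 16 x 1 x 2 b 10 x 2 x 0 x 1" ∷
  "b 8 x 4 x 0 x 1 b 7 x 0 x 13 b 6 x 0 x 3 b 2 b 29 x 1 b 24 x 10 x 1 b 27 b 24 x 9 x 1 x 0 x 5 x 0" ∷
  "x 6 x 10 x 0 b 28 x 0 b 26 x 7 b 24 x 12 x 3 x 1 x 0 x 0 x 2 x 5 x 9 x 0 x 1 x 5 x 3 x 1 x 2 x 7 x 2" ∷
  "x 2 x 8 x 0 x 3 x 6 x 2 x 0 x 3 x 1 x 0 x 3 x 4 x 11 x 2 x 1 x 11 x 2 x 1 x 1 x 0 x 1 x 4 x 0 x 2" ∷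
  "x 3 x 4 x 6 x 8 x 3 x 0 x 2 x 3 b 57 b 48 x 1 x 2 x 0 b 47 b 48 b 47 x 8 x 1 x 2 b 45 b 44 b 42 x 5" ∷
  "x 1 b 39 x 0 x 2 b 37 x 0 x 4 x 11 b 37 x 0 x 3 b 42 x 1 x 3 b 40 b 41 x 8 x 0 b 43 b 42 b 39 b 40" ∷
  "b 39 x 6 b 38 b 37 x 9 x 3 b 36 x 12 x 6 b 35 x 17 x 2 x 3 b 34 x 0 b 33 x 0 x 7 b 32 b 31 b 30 x 22" ∷
  "x 2 x 0 b 29 b 28 b 27 x 2 x 13 b 26 x 0 x 5 b 25 x 0 x 3 x 1 b 24 x 9 x 1 x 3 b 23 x 20 x 1 x 2" ∷
  "b 22 x 1 x 6 x 2 b 21 x 0 x 1 b 20 x 12 x 9 x 0 b 19 x 2 x 0 b 18 x 34 x 1 x 6 b 17 x 3 b 16 x 3 x 1" ∷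
  "x 5 b 15 x 17 x 6 x 0 b 14 x 7 x 1 x 2 b 13 x 1 x 0 b 12 x 0 x 1 b 11 x 6 x 1 b 10 x 2 x 5 x 1 b 9" ∷
  "b 8 b 7 x 2 x 0 x 11 b 6 x 8 x 2 x 0 b 5 b 4 x 10 x 12 x 0 b 3 x 2 x 1 x 0 b 2 b 1 x 9 x 2 x 8 b 0" ∷
  "x 9 x 17 d 2 4 x 0 x 1 x 9 x 7 x 6 x 2 x 0 x 1 x 13 x 11 x 0 x 7 x 21 x 4 x 6 x 14 x 9 x 14 x 8 x 20" ∷
  "x 1 x 0 x 3 x 0 x 25 x 11 x 8 x 0 x 0 x 1 x 13 x 1 x 2 x 13 x 6 x 2 x 3 x 2 x 0 x 9 x 8 x 0 x 0 x 4" ∷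
  "x 0 x 6 x 2 x 4 x 19 x 3 x 0 x 8 x 2 x 3 x 0 x 1 x 4 x 0 x 3 x 5 x 0 x 6 x 7 x 3 x 1 x 12 x 5 x 0" ∷
  "x 1 x 9 x 1 x 0 x 2 x 2 x 3 x 5 x 1 x 4 x 0 b 49 x 3 b 37 x 0 b 32 x 2 b 41 x 0 b 28 x 4 b 49 x 0" ∷
  "b 49 x 1 b 48 x 1 b 42 x 0 b 37 x 13 b 41 x 7 b 47 x 11 b 44 x 2 b 43 b 42 x 3 b 41 x 4 b 40 x 3" ∷
  "b 41 x 0 b 40 x 8 b 39 x 0 b 38 x 0 b 37 x 8 b 36 x 15 b 35 x 2 b 34 x 12 b 33 x 1 b 32 b 31 x 2" ∷
  "b 30 x 6 b 29 x 0 b 28 x 2 b 27 x 3 b 26 x 1 b 25 b 24 x 6 b 23 x 5 b 22 x 14 b 21 x 1 b 20 x 26" ∷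
  "b 19 b 18 x 2 b 17 b 16 x 16 b 15 b 14 b 13 x 2 b 12 b 11 x 4 b 10 x 0 b 9 x 6 b 8 x 2 b 7 b 6 x 6" ∷
  "b 5 x 0 b 4 x 3 b 3 b 2 x 2 b 1 x 11 b 0 x 0 d 0 2 x 20 x 2 x 0 x 9 x 0 x 8 x 3 x 15 x 0 x 4 x 0" ∷
  "x 12 x 6 x 2 x 7 x 6 x 3 x 1 x 18 x 0 x 2 x 18 x 7 x 1 x 1 x 0 x 2 x 1 x 0 x 1 x 8 x 0 x 15 x 4 x 2" ∷
  "x 16 x 1 x 0 x 3 x 0 x 7 x 17 x 0 x 5 x 2 x 0 x 5 x 1 x 0 x 2 x 8 x 3 x 27 x 4 x 1 x 16 x 2 x 1 x 0" ∷
  "x 3 x 7 x 8 x 1 x 8 x 1 x 3 x 2 x 5 x 7 x 3 x 0 x 1 x 6 x 0 x 24 x 0 x 8 x 2 x 1 x 4 x 22 x 1 x 2" ∷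
  "x 19 x 5 x 6 x 3 x 16 x 8 x 1 x 2 x 2 x 1 x 8 x 19 x 7 x 0 x 6 x 15 x 0 x 1 x 14 x 3 x 0 x 5 x 0 x 0" ∷
  "x 2 x 6 x 0 x 3 x 1 x 0 x 5 x 0 x 2 x 1 x 6 x 8 x 0 x 5 x 2 x 1 x 7 x 2 x 1 b 45 x 0 b 56 x 2 b 54" ∷
  "x 2 b 52 x 1 x 3 b 43 b 38 x 4 b 35 x 0 b 32 x 0 x 2 b 43 x 10 x 0 b 47 x 1 x 0 b 42 x 1 x 0 b 29" ∷
  "b 24 x 6 x 0 x 7 b 23 x 7 b 22 x 1 x 2 x 9 b 20 x 13 b 19 x 1 b 16 x 10 b 15 x 1 x 3 x 5 b 14 x 4" ∷
  "b 12 x 1 b 9 x 1 b 8 b 6 x 4 x 8 x 0 b 5 b 4 x 6 x 5 x 0 b 3 x 2 x 1 x 0 b 1 x 6 x 1 b 29 x 6 b 19" ∷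
  "x 2 b 15 x 0 x 3 x 1 x 14 x 0 x 8 x 1 b 25 x 0 b 22 x 0 x 2 x 1 x 16 x 3 x 1 x 7 x 7 x 1 x 0 x 1 x 7" ∷
  "x 0 x 7 x 14 x 6 x 0 x 2 x 3 x 2 x 1 x 0 x 6 x 2 x 1 x 11 x 4 x 3 x 13 x 4 x 10 x 5 x 4 x 7 x 3 x 5" ∷
  "x 1 x 11 x 0 x 7 x 2 x 5 x 1 x 0 x 0 x 1 x 1 x 4 x 0 b 56 b 48 x 2 b 39 b 35 x 1 x 2 b 32 b 16 x 5" ∷
  "x 1 x 0 b 14 b 6 x 1 b 49 b 48 b 46 x 11 x 0 b 11 x 0 x 2 x 4 x 12 x 1 x 3 x 0 x 11 b 48 x 0 x 3" ∷
  "b 43 x 2 b 36 x 0 x 1 x 3 x 15 x 1 x 11 x 11 x 11 x 1 x 2 x 0 x 0 x 5 x 2 x 1 x 2 x 0 x 0 x 1 x 0" ∷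
  "x 4 x 0 x 1 x 0 b 9 x 1 x 0 b 52 x 3 x 0 x 1 b 47 x 4 x 0 b 52 x 3 x 0 b 47 x 0 x 1 b 46 x 2 x 1" ∷
  "b 44 x 1 x 6 b 49 x 3 x 0 x 11 b 41 b 44 x 1 x 0 b 42 x 6 x 1 x 11 b 39 x 1 x 0 x 2 b 44 x 0 x 3" ∷
  "b 39 x 0 x 2 x 5 b 38 b 37 b 36 b 35 x 5 x 1 x 9 b 34 x 4 x 8 b 33 x 11 x 2 b 37 x 1 x 0 b 36 x 8" ∷
  "x 0 x 3 b 35 x 2 x 3 b 34 x 1 x 4 b 33 x 1 x 0 x 6 b 32 b 31 x 4 x 0 b 30 x 5 x 1 b 29 x 3 x 7 b 28" ∷
  "x 4 x 1 x 0 b 27 x 3 x 1 x 4 b 26 x 8 x 3 x 0 b 25 x 5 x 0 x 8 b 24 x 1 x 5 b 23 b 22 b 21 x 2 x 3" ∷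
  "b 20 b 19 x 5 x 0 b 18 x 0 b 17 x 3 x 5 b 16 x 0 x 5 b 15 x 1 x 4 b 14 x 3 x 1 b 13 x 0 b 12 b 11" ∷
  "x 4 b 10 x 13 x 7 x 3 b 9 b 8 x 5 x 2 x 0 b 7 x 0 x 30 b 6 x 0 x 3 b 5 x 9 x 1 x 3 b 4 x 1 x 0 b 3" ∷
  "x 9 x 2 b 2 x 1 x 4 b 1 x 4 x 7 b 0 x 12 x 8 x 1 d 0 4 x 0 x 0 x 15 x 7 x 1 x 1 x 0 x 6 x 2 x 0 x 1" ∷
  "x 1 x 3 x 0 x 4 x 2 x 0 x 8 x 20 x 0 x 1 x 9 x 7 x 8 x 1 x 2 x 1 x 14 x 0 x 2 x 5 x 0 x 1 x 11 x 5" ∷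
  "x 14 x 7 x 12 x 2 x 7 x 6 x 0 x 7 x 13 x 0 x 5 x 1 x 0 x 5 x 2 x 0 x 0 x 3 x 8 x 6 x 4 x 2 x 0 x 13" ∷
  "x 7 x 0 x 3 x 6 x 3 x 3 x 1 x 1 x 3 x 0 x 4 x 0 x 2 x 5 x 1 x 0 x 2 x 1 b 55 x 1 x 0 x 2 b 58 x 1" ∷
  "x 0 b 50 b 60 x 3 b 50 x 0 b 48 x 0 x 4 b 58 x 2 x 0 b 46 b 40 x 7 x 8 x 0 b 49 x 2 b 52 x 0 b 52" ∷
  "x 0 x 2 b 47 x 7 b 51 b 50 b 47 x 3 x 15 b 46 x 6 x 0 b 47 x 1 x 0 b 46 x 0 b 44 x 0 x 5 b 43 x 16" ∷
  "x 0 b 42 x 9 x 13 b 41 x 2 b 40 x 1 b 40 x 0 b 39 x 4 b 38 x 2 x 17 x 0 b 37 x 0 x 2 x 5 b 36 x 1" ∷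
  "x 20 x 15 b 35 b 34 x 2 x 0 b 33 x 3 b 32 x 6 x 1 b 31 b 30 b 29 b 28 b 27 b 26 x 16 x 7 b 25 x 15" ∷
  "b 24 x 7 b 23 x 2 x 23 x 5 b 22 x 0 b 21 x 15 x 7 b 20 x 0 b 19 x 2 x 10 b 18 x 0 b 17 x 1 b 16 x 3" ∷
  "x 6 b 15 x 0 x 9 x 2 b 14 x 2 x 0 b 13 x 0 x 1 x 8 b 12 x 4 x 0 x 3 b 11 x 2 x 0 b 10 x 6 x 4 x 0" ∷
  "b 9 x 1 b 8 x 4 x 1 b 7 x 0 x 4 x 14 b 6 x 2 x 6 x 0 b 5 x 3 x 2 b 4 x 1 x 6 x 2 b 3 x 3 b 2 x 3 x 1" ∷
  "b 1 x 3 x 2 b 0 x 4 d 1 5 x 1 x 3 x 0 x 14 x 0 x 1 x 1 x 3 x 2 x 14 x 12 x 5 x 17 x 5 x 6 x 19 x 9" ∷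
  "x 0 x 11 x 6 x 0 x 2 x 17 x 1 x 2 x 0 x 6 x 0 x 0 x 2 x 3 x 1 x 0 x 2 x 4 x 0 x 1 x 1 x 4 x 0 x 0" ∷
  "x 1 x 8 x 3 x 2 x 7 x 1 x 7 x 1 x 4 x 0 x 2 x 1 x 9 x 2 x 5 x 5 x 4 x 1 x 1 x 14 x 10 x 2 x 4 x 5" ∷
  "x 0 x 6 x 2 x 0 x 7 x 3 x 0 x 1 x 2 x 7 x 5 x 1 x 0 x 12 x 0 x 9 x 3 x 7 x 6 x 1 x 4 x 0 x 1 x 1 x 4" ∷
  "x 3 x 2 x 0 x 0 x 2 x 0 x 1 x 0 b 67 x 0 b 41 b 21 x 3 x 0 x 1 b 19 b 49 x 3 x 0 b 16 b 60 b 43 b 25" ∷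
  "x 3 x 0 b 48 b 48 x 7 x 6 x 0 b 45 x 2 x 0 x 4 b 46 x 9 x 0 b 54 x 12 b 53 x 1 x 2 b 52 x 4 b 51 x 1" ∷
  "b 49 x 3 x 4 b 48 b 45 b 47 x 7 b 44 b 43 b 42 x 5 x 4 x 0 b 41 b 40 b 41 x 2 b 40 b 39 x 1 x 13 x 7" ∷
  "b 38 x 0 x 4 x 1 b 37 x 13 x 0 b 36 x 0 b 35 x 1 x 23 x 0 b 34 x 3 b 33 b 32 b 31 x 2 x 0 b 30 x 4" ∷
  "x 1 b 29 x 5 x 8 x 3 b 28 b 27 x 3 b 26 b 25 x 3 x 4 x 0 b 24 x 0 b 23 x 1 x 4 x 5 b 22 x 14 x 5 x 1" ∷
  "b 21 b 20 x 1 x 7 x 2 b 19 x 0 x 18 x 1 b 18 x 1 x 0 x 12 b 17 b 16 x 2 b 15 x 2 x 1 x 7 b 14 x 1" ∷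
  "x 0 x 3 b 13 x 6 x 0 x 4 b 12 x 3 x 0 b 11 x 3 b 10 x 5 x 4 b 9 x 0 b 8 x 1 b 7 b 6 x 2 x 1 b 5 x 0" ∷
  "x 13 b 4 x 4 x 23 b 3 x 6 b 2 x 1 b 1 x 3 b 0 x 0 x 6 d 7 8 x 8 x 0 x 5 x 4 x 13 x 4 x 1 x 1 x 6" ∷
  "x 10 x 6 x 14 x 0 x 31 x 7 x 3 x 1 x 10 x 9 x 13 x 14 x 0 x 8 x 1 x 9 x 6 x 1 x 2 x 4 x 1 x 11 x 17" ∷
  "x 0 x 8 x 0 x 5 x 1 x 3 x 0 x 9 x 1 x 9 x 0 x 1 x 5 x 0 x 2 x 13 x 0 x 4 x 25 x 11 x 0 x 2 x 4 x 0" ∷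
  "x 1 x 0 x 1 x 3 x 5 x 7 x 2 x 2 x 1 x 9 x 2 x 11 x 1 x 0 x 4 x 9 x 2 x 1 x 0 x 1 x 9 x 0 x 8 x 0 x 0" ∷
  "x 1 x 0 x 3 x 0 x 7 x 0 x 5 x 2 x 7 x 3 x 1 x 0 b 43 x 0 x 3 x 1 b 44 x 0 x 4 b 56 x 4 x 0 b 54 x 7" ∷
  "x 0 x 2 b 55 x 0 b 49 x 1 x 2 b 48 x 0 b 46 x 7 x 3 b 51 x 1 x 0 b 51 x 4 x 5 b 50 b 49 x 6 x 3 x 1" ∷
  "b 48 x 4 x 1 b 47 x 0 b 46 x 0 x 1 b 45 x 5 b 44 x 6 x 1 b 43 x 2 x 6 x 11 b 42 x 8 x 1 x 2 b 41 x 5" ∷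
  "x 10 x 1 b 40 b 39 b 38 x 8 b 37 b 36 x 5 x 2 b 35 b 34 x 9 x 2 b 33 x 4 b 32 x 1 b 31 b 30 x 7 x 6" ∷
  "x 0 b 29 x 2 b 28 x 4 x 11 b 27 x 0 x 7 b 26 x 1 x 8 b 25 x 0 b 24 x 2 b 23 b 22 x 5 x 3 x 1 b 21" ∷
  "b 20 x 1 x 7 x 4 b 19 x 0 x 6 x 1 b 18 x 1 x 0 b 17 b 16 x 2 b 15 x 4 x 1 b 14 x 1 x 6 x 18 b 13 x 1" ∷
  "x 0 b 12 x 2 x 7 x 19 b 11 b 10 x 5 b 9 b 8 b 7 b 6 x 5 b 5 b 4 x 7 b 3 x 14 x 1 b 2 b 1 b 0 d 5 6" ∷
  "x 6 x 0 x 4 x 3 x 11 x 1 x 2 x 4 x 0 x 0 x 0 x 2 x 7 x 0 x 10 x 2 x 10 x 4 x 1 x 9 x 0 x 9 x 1 x 21" ∷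
  "x 1 x 0 x 12 x 0 x 0 x 1 x 16 x 4 x 7 x 0 x 15 x 1 x 5 x 6 x 4 x 8 x 2 x 1 x 9 x 1 x 13 x 15 x 14" ∷
  "x 11 x 6 x 4 x 14 x 3 x 7 x 0 x 4 x 8 x 0 x 0 x 5 x 1 x 3 x 0 x 3 x 2 x 16 x 1 x 6 x 2 x 1 x 5 x 1" ∷
  "x 1 x 9 x 0 x 1 x 0 x 6 x 2 x 14 x 9 x 16 x 2 x 5 x 5 x 0 x 4 x 2 x 0 x 10 x 0 x 3 x 7 x 0 x 1 x 10" ∷
  "x 5 x 3 x 4 x 0 x 6 x 2 x 1 x 2 x 0 x 3 x 2 x 1 x 0 x 2 b 55 x 0 b 50 x 0 x 1 b 56 x 4 x 0 b 49 x 3" ∷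
  "x 4 b 59 x 4 x 0 b 43 b 49 x 2 x 0 b 50 x 6 x 4 b 56 x 0 x 8 x 2 b 53 x 0 x 1 b 51 x 5 b 50 x 9 x 5" ∷
  "x 1 b 48 x 5 x 0 x 3 b 47 x 3 x 1 b 42 x 1 b 41 b 40 x 3 x 5 b 38 b 37 x 7 x 2 b 36 x 4 x 5 x 1 b 35" ∷
  "x 1 x 10 b 34 x 7 x 5 b 32 x 3 x 0 b 28 x 2 x 0 x 8 b 25 x 11 x 3 b 24 x 0 x 6 b 23 x 4 x 1 x 8 b 19" ∷
  "b 17 x 5 b 12 x 0 x 2 x 10 b 11 x 4 x 0 b 10 x 2 x 5 x 0 b 7 x 0 x 2 b 6 x 0 x 10 b 5 x 0 x 6 b 4" ∷
  "x 2 x 4 b 3 x 9 x 3 b 29 b 26 x 2 x 6 x 0 b 27 b 22 x 3 x 9 x 1 x 0 x 3 x 9 x 0 x 0 b 28 x 0 x 2 x 8" ∷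
  "b 26 x 3 x 7 b 23 x 2 x 3 x 13 x 0 x 0 x 2 x 1 x 1 x 2 x 5 x 4 x 8 x 1 x 0 x 5 x 9 x 19 x 1 x 0 x 2" ∷
  "x 1 x 5 x 0 x 3 x 2 x 1 x 0 x 2 x 5 x 10 x 0 x 6 x 13 x 1 x 0 x 2 x 0 x 1 x 5 x 6 x 0 x 1 x 2 x 1" ∷
  "x 3 x 1 x 2 x 1 b 68 b 66 b 39 b 51 b 51 b 48 b 62 b 59 b 46 b 32 b 58 x 10 x 1 b 41 x 0 x 11 b 46" ∷
  "x 12 x 1 b 28 x 2 x 1 b 16 x 1 b 14 x 1 x 15 b 12 x 3 x 0 b 5 x 2 x 1 b 3 x 3 b 49 b 48 b 47 x 2" ∷
  "b 42 b 41 b 39 b 38 x 6 b 31 x 4 x 5 x 2 x 0 x 1 x 4 x 4 x 0 x 15 x 2 x 13 x 0 x 3 x 0 x 14 x 11 x 1" ∷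
  "x 0 x 11 x 2 x 10 b 48 x 0 b 38 x 2 x 1 x 11 b 37 x 7 b 43 x 0 b 42 x 2 x 8 x 1 b 41 x 9 x 1 b 41" ∷
  "x 0 b 40 x 2 x 5 b 40 x 1 x 0 x 3 b 39 x 0 x 4 x 5 b 38 x 8 x 11 x 0 b 37 x 2 b 36 x 3 x 1 x 2 b 35" ∷
  "x 10 x 8 x 0 b 34 x 5 x 0 x 26 b 33 x 0 x 4 x 3 b 32 x 13 x 1 x 6 b 31 x 2 x 0 x 5 b 30 x 0 x 3 x 2" ∷
  "b 29 x 1 x 9 x 5 b 28 x 4 x 9 x 1 b 27 x 0 x 7 b 26 x 3 b 25 x 9 b 24 x 8 x 4 x 0 b 23 x 4 x 3 x 2" ∷
  "b 22 x 0 x 1 x 9 b 21 x 1 x 5 b 20 x 1 x 19 x 0 b 19 x 2 x 4 x 1 b 18 x 1 x 3 b 17 x 2 x 1 x 3 b 16" ∷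
  "x 0 x 7 x 3 b 15 x 4 x 0 b 14 x 3 x 1 b 13 x 0 x 3 x 11 b 12 x 1 x 0 b 11 x 0 x 3 b 10 x 0 x 5 b 9" ∷
  "x 21 b 8 x 4 x 18 x 17 b 7 x 19 b 6 x 7 x 1 x 6 b 5 x 2 x 15 x 0 b 4 x 2 x 24 x 0 b 3 x 0 x 8 x 1" ∷
  "b 2 x 1 x 0 x 7 b 1 x 22 x 0 x 8 b 0 x 7 d 0 6 x 11 x 0 x 11 x 1 x 0 x 8 x 1 x 24 x 8 x 8 x 10 x 18" ∷
  "x 4 x 0 x 10 x 2 x 15 x 1 x 8 x 4 x 0 x 2 x 5 x 0 x 1 x 4 x 1 x 12 x 11 x 2 x 0 x 1 x 0 x 0 x 1 x 0" ∷
  "x 0 x 14 x 0 x 0 x 4 b 41 b 54 b 55 b 54 b 42 x 15 x 2 x 4 x 0 x 0 x 5 x 14 x 4 x 1 x 0 x 0 x 2 x 1" ∷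
  "x 11 x 0 x 4 x 0 x 3 x 2 x 0 x 6 x 1 x 4 x 0 x 2 x 2 x 0 x 1 x 0 x 1 x 2 x 2 x 0 x 1 x 0 x 2 x 1 x 2" ∷
  "x 1 x 0 b 45 x 2 b 39 x 1 x 3 x 0 b 56 b 52 b 46 x 3 b 44 x 4 b 60 x 4 b 41 x 0 x 4 x 6 b 56 b 39" ∷
  "x 3 x 0 b 49 b 29 x 3 b 28 x 11 x 2 b 49 x 8 b 52 x 2 x 1 b 44 x 8 b 45 x 0 x 1 b 48 b 46 x 4 x 0" ∷
  "b 45 b 44 x 3 b 43 x 2 x 6 x 1 b 44 b 42 b 41 b 40 b 39 x 16 x 11 b 39 x 10 x 0 b 38 x 11 x 4 x 6" ∷
  "b 37 x 14 x 3 x 2 b 36 x 1 x 0 b 35 x 3 x 15 x 1 b 34 x 2 b 33 x 3 b 32 x 2 b 31 x 0 x 4 b 30 x 2" ∷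
  "x 7 x 0 b 29 x 4 x 1 b 28 x 0 x 11 b 27 x 0 x 7 x 2 b 26 x 13 x 7 x 5 b 25 x 1 x 5 b 24 x 0 x 1 x 8" ∷
  "b 23 b 22 x 3 x 0 b 21 x 9 b 20 b 19 x 11 b 18 x 3 x 0 b 17 b 16 b 15 b 14 x 9 x 14 x 1 b 13 x 4 x 0" ∷
  "x 1 b 12 b 11 x 10 b 10 x 10 x 6 b 9 x 0 b 8 x 1 x 6 x 7 b 7 b 6 x 2 x 5 x 1 b 5 x 3 x 17 x 6 b 4" ∷
  "x 1 x 0 b 3 x 4 b 2 x 1 x 9 x 4 b 1 b 0 d 4 5 x 6 x 0 x 1 x 0 x 12 x 5 x 2 x 3 x 2 x 6 x 0 x 2 x 3" ∷
  "x 1 x 7 x 0 x 4 x 0 x 4 x 2 x 0 x 6 x 2 x 0 x 11 x 3 x 6 x 1 x 3 x 6 x 0 x 3 x 5 x 0 x 2 x 0 x 1 x 9" ∷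
  "x 1 x 2 x 6 x 13 x 2 x 3 x 21 x 22 x 0 x 0 x 2 x 11 x 20 x 23 x 3 x 3 x 1 x 2 x 0 x 2 x 4 x 1 x 0" ∷
  "x 3 x 4 x 0 x 3 x 1 x 8 x 0 x 5 x 3 x 0 x 5 x 0 x 1 x 4 x 4 x 3 x 2 x 0 x 1 x 0 x 5 x 2 x 0 x 2 x 0" ∷
  "x 1 x 2 x 4 x 0 x 2 x 0 x 1 x 2 x 5 x 5 x 0 x 4 x 0 x 1 x 3 x 0 x 2 x 1 x 0 x 0 x 1 b 63 b 56 b 46" ∷
  "x 3 b 56 b 42 x 1 x 0 x 3 b 40 x 2 x 0 b 29 x 1 b 21 x 1 b 20 b 53 x 9 b 43 x 10 x 4 x 0 b 46 x 11" ∷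
  "x 0 x 4 b 52 x 1 x 0 x 3 b 54 x 2 x 0 x 1 b 48 x 2 x 0 x 1 b 44 x 5 b 43 x 1 x 5 x 2 b 47 x 3 x 0" ∷
  "x 2 b 41 x 1 x 12 x 2 b 46 x 0 x 1 b 42 b 44 x 2 b 43 b 44 b 43 x 4 b 42 x 0 x 4 x 3 b 41 b 40 x 10" ∷
  "x 0 b 39 x 20 x 0 x 7 b 38 x 0 x 9 b 37 x 0 x 4 b 36 x 3 x 11 b 35 x 3 b 34 b 33 b 32 x 2 x 0 b 31" ∷
  "b 30 x 11 b 29 b 28 x 3 b 27 x 8 b 26 x 0 x 11 x 16 b 25 x 9 x 18 b 24 x 0 x 4 b 23 b 22 x 7 b 21" ∷
  "x 2 x 4 b 20 x 1 b 19 x 0 x 3 x 11 b 18 x 5 x 4 x 9 b 17 x 7 x 0 b 16 x 1 b 15 x 1 b 14 b 13 b 12" ∷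
  "x 6 x 16 b 11 b 10 x 4 b 9 b 8 b 7 x 11 x 16 x 1 b 6 b 5 x 10 b 4 b 3 x 3 x 4 x 8 b 2 x 2 x 4 b 1" ∷
  "x 10 x 5 b 0 x 11 x 3 x 1 d 5 7 x 0 x 1 x 10 x 1 x 0 x 3 x 1 x 9 x 0 x 6 x 0 x 4 x 1 x 5 x 1 x 0 x 2" ∷
  "x 0 x 7 x 16 x 1 x 0 x 5 x 0 x 1 x 6 x 11 x 0 x 10 x 0 x 8 x 0 x 4 x 3 x 2 x 1 x 0 x 3 x 5 x 0 x 1" ∷
  "x 5 x 1 x 0 x 12 x 0 x 5 x 2 x 3 x 4 x 0 x 13 x 1 x 5 x 12 x 1 x 10 x 0 x 1 x 4 x 0 x 2 x 4 x 12 x 5" ∷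
  "x 7 x 1 x 4 x 0 x 1 x 17 x 6 x 1 x 2 x 0 x 3 x 7 x 0 x 12 x 4 x 0 x 0 x 2 x 20 x 3 x 2 x 15 b 45 x 3" ∷
  "x 0 b 46 x 1 b 43 x 12 x 6 b 44 x 0 b 40 x 7 x 1 b 51 x 3 b 39 x 0 x 1 b 38 x 1 x 12 b 34 x 1 x 4" ∷
  "x 0 b 32 x 6 x 1 x 0 b 31 x 0 x 2 x 12 b 37 x 0 b 43 x 0 b 35 x 0 x 3 b 30 x 5 b 24 x 7 x 16 b 22" ∷
  "x 1 b 21 x 1 b 20 x 1 b 15 x 3 x 7 b 13 x 0 x 11 x 1 b 9 x 3 b 7 x 4 x 6 x 3 b 6 x 1 x 2 x 0 b 4 x 0" ∷
  "b 3 x 2 b 2 x 2 x 3 b 1 x 9 x 3 b 29 x 0 b 22 b 12 x 1 x 6 x 0 x 2 x 1 x 11 x 0 x 8 b 28 x 4 b 21" ∷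
  "x 4 x 1 x 0 x 3 x 0 x 3 x 0 x 8 x 1 x 0 x 1 x 6 x 0 x 4 x 1 x 2 x 11 x 4 x 3 x 0 x 2 x 0 x 2 x 16" ∷
  "x 1 x 1 x 2 x 10 x 1 x 2 x 2 x 0 x 1 x 0 x 1 x 3 x 0 x 4 x 0 x 10 x 1 x 1 x 0 x 5 x 6 x 0 x 2 x 0" ∷
  "x 1 x 2 x 0 x 1 x 2 x 0 x 2 x 1 x 0 x 1 x 0 b 56 x 0 x 2 x 1 b 51 x 3 x 0 b 50 x 2 x 1 x 0 b 49 x 4" ∷
  "b 61 x 0 x 1 b 57 x 6 b 48 x 4 x 1 b 59 x 4 x 0 b 58 x 3 x 1 b 51 x 1 x 0 b 47 x 5 b 46 x 2 x 3 x 1" ∷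
  "b 45 x 1 b 52 b 52 b 51 b 50 b 49 b 48 x 16 x 15 x 0 b 47 b 46 x 9 b 45 x 10 b 44 b 43 x 1 x 5 b 42" ∷
  "b 41 x 1 x 2 b 40 x 0 b 39 x 5 x 2 x 0 b 38 x 7 x 5 b 37 b 36 b 35 b 34 x 4 x 0 x 6 b 33 x 5 x 4 x 3" ∷
  "b 32 x 5 b 31 b 30 b 29 x 3 b 28 x 3 x 1 b 27 x 0 b 26 x 1 x 2 x 5 b 25 b 24 b 23 x 3 b 22 x 3 b 21" ∷
  "b 20 b 19 x 2 x 5 x 0 b 18 b 17 x 41 x 1 x 0 b 16 x 17 b 15 b 14 x 11 x 9 b 13 x 0 x 4 x 1 b 12 x 6" ∷
  "x 0 b 11 x 2 x 5 x 12 b 10 x 5 x 0 b 9 x 0 x 1 x 3 b 8 x 0 x 6 b 7 x 0 b 6 b 5 x 1 x 2 b 4 x 3 b 3" ∷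
  "x 6 b 2 x 4 x 5 b 1 x 3 b 0 x 0 x 9 x 1 d 3 6 x 5 x 0 x 8 x 8 x 0 x 1 x 5 x 6 x 6 x 14 x 4 x 8 x 1" ∷
  "x 9 x 13 x 2 x 1 x 1 x 10 x 0 x 0 x 1 x 1 x 13 x 8 x 2 x 4 x 10 x 2 x 1 x 0 x 1 x 2 x 2 x 1 x 1 x 0" ∷
  "x 5 x 2 x 1 x 3 x 2 x 3 x 2 x 0 x 1 x 3 x 4 x 0 x 3 x 2 x 5 x 3 x 0 x 0 x 8 x 1 x 11 x 0 x 2 x 7 x 5" ∷
  "x 2 x 0 x 1 x 8 x 0 x 6 x 2 x 1 x 0 x 2 x 16 x 0 x 0 x 7 x 1 x 8 x 7 x 0 x 2 x 1 x 7 x 2 x 2 x 5 x 1" ∷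
  "x 8 x 2 x 0 x 6 x 0 x 10 x 3 x 0 x 6 x 7 x 6 x 2 x 8 x 3 x 8 x 3 x 2 x 5 x 1 x 6 x 0 x 1 x 2 b 66" ∷
  "x 0 b 45 x 2 x 1 b 43 x 1 x 3 b 59 x 0 x 3 b 50 x 3 x 4 b 59 x 0 x 6 b 57 x 2 x 6 b 56 x 1 x 0 b 56" ∷
  "x 8 x 0 b 55 x 2 x 6 b 54 x 0 b 51 x 0 x 1 b 53 x 0 b 54 x 4 b 52 b 50 x 6 x 10 b 49 x 7 x 12 b 48" ∷
  "b 48 b 47 x 6 x 4 b 46 x 3 b 45 x 5 x 1 b 44 x 2 x 6 b 43 x 16 x 4 b 42 x 10 x 2 b 42 x 4 x 0 b 41" ∷
  "x 0 b 40 x 2 x 3 b 39 x 3 x 0 b 38 x 2 b 37 x 6 b 36 x 0 x 24 b 35 x 2 x 1 b 34 b 33 b 32 x 11 x 0" ∷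
  "b 31 x 3 x 0 b 30 x 0 x 1 b 29 x 1 x 13 b 28 x 0 x 3 b 27 x 0 x 4 b 26 x 0 b 25 x 5 x 2 b 24 x 0" ∷
  "b 23 b 22 x 1 x 0 b 21 x 4 b 20 x 5 b 19 b 18 x 1 b 17 x 9 b 16 x 3 b 15 x 11 b 14 x 2 x 3 b 13 x 0" ∷
  "b 12 x 4 x 1 b 11 x 2 x 15 b 10 x 4 b 9 x 1 x 3 b 8 x 5 b 7 b 6 x 10 x 1 b 5 x 0 x 8 b 4 b 3 x 11" ∷
  "b 2 b 1 x 3 x 16 b 0 x 4 x 3 d 0 3 x 17 x 2 x 11 x 4 x 1 x 4 x 1 x 6 x 5 x 1 x 5 x 2 x 22 x 2 x 0" ∷
  "x 0 x 1 x 0 x 0 x 12 x 12 x 3 x 10 x 1 x 0 x 2 x 0 x 10 x 2 x 7 x 1 x 0 x 6 x 9 x 14 x 0 x 0 x 2 x 0" ∷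
  "x 1 x 4 x 1 x 20 x 2 x 3 x 10 x 1 x 2 x 14 x 8 x 4 x 4 x 5 x 17 x 5 x 2 x 0 x 7 x 4 x 1 x 15 x 13" ∷
  "x 1 x 0 x 5 x 9 x 6 x 5 x 7 x 2 x 3 x 1 x 1 x 1 x 3 x 4 x 1 x 12 x 2 x 0 x 8 x 2 x 5 x 0 x 4 x 3 x 2" ∷
  "x 8 x 6 x 1 x 0 x 2 x 4 x 11 x 6 x 9 x 2 x 3 x 1 x 4 x 1 x 1 x 0 x 2 x 0 x 0 b 45 x 2 x 1 x 0 b 61" ∷
  "x 0 b 49 x 1 b 58 b 38 x 5 x 0 x 1 b 61 b 58 b 45 x 7 x 0 b 44 x 5 b 43 x 0 b 56 x 10 x 4 x 0 b 55" ∷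
  "x 3 b 54 b 52 b 47 b 46 x 3 x 0 x 8 b 50 x 4 x 0 x 14 b 45 x 8 x 2 b 48 x 0 b 46 x 8 b 44 x 3 x 5" ∷
  "b 43 x 3 x 16 b 44 b 42 b 41 x 5 x 1 x 2 b 39 x 16 x 0 b 38 b 37 x 6 x 2 b 38 x 8 b 37 x 4 b 36 x 1" ∷
  "x 8 b 35 x 3 x 4 x 2 b 34 x 0 x 11 x 1 b 33 b 32 x 5 x 0 b 31 b 30 b 29 x 5 b 28 b 27 b 26 b 25 x 11" ∷
  "b 24 x 7 x 14 b 23 x 11 b 22 x 6 x 13 x 2 b 21 x 0 b 20 b 19 b 18 b 17 x 4 b 16 x 17 x 7 b 15 x 0" ∷
  "x 2 b 14 x 2 x 1 b 13 x 0 x 4 b 12 x 2 x 1 x 3 b 11 x 2 x 0 x 1 b 10 x 6 x 0 x 15 b 9 x 6 x 1 x 2" ∷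
  "b 8 x 0 x 1 b 7 x 0 x 4 b 6 x 0 x 21 b 5 x 0 x 2 b 4 x 2 b 3 b 2 b 1 x 3 b 0 x 0 d 4 7 x 7 x 2 x 1" ∷
  "x 15 x 5 x 0 x 8 x 3 x 10 x 0 x 9 x 1 x 4 x 4 x 1 x 3 x 12 x 8 x 4 x 1 x 0 x 1 x 1 x 0 x 9 x 2 x 0" ∷
  "x 5 x 1 x 0 x 5 x 1 x 3 x 6 x 9 x 1 x 2 x 3 x 2 x 9 x 0 x 0 x 2 x 3 x 1 x 18 x 2 x 0 x 1 x 1 x 9 x 0" ∷
  "x 0 x 2 x 12 x 4 x 2 x 12 x 3 x 7 x 5 x 0 x 3 x 0 x 27 x 0 x 11 x 6 x 1 x 0 x 6 x 2 x 8 x 0 x 10 x 7" ∷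
  "x 0 x 4 x 0 x 4 x 12 x 5 x 3 x 0 x 2 x 6 x 0 x 3 x 4 x 6 x 1 x 1 x 6 x 8 x 1 x 3 x 1 x 1 x 5 x 0 x 4" ∷
  "x 0 x 2 x 1 x 3 x 0 x 1 x 3 x 0 b 49 x 1 x 0 x 3 b 38 x 4 x 2 b 31 x 2 x 0 b 23 x 2 x 0 b 2 x 0 x 4" ∷
  "x 1 b 59 x 2 b 57 b 48 x 3 b 54 b 51 b 52 b 44 x 3 b 43 b 43 x 8 b 49 x 2 x 4 b 48 x 0 b 47 x 1 x 0" ∷
  "x 5 b 46 x 5 x 0 b 45 x 0 x 1 x 2 b 43 x 11 x 6 b 43 x 6 x 0 x 1 b 41 x 5 b 40 x 0 b 40 x 6 b 39" ∷
  "b 38 x 3 x 12 b 38 x 7 x 0 x 1 b 37 x 3 b 36 x 2 b 35 x 3 x 4 x 0 b 34 x 3 x 5 b 33 x 8 x 4 b 32 x 1" ∷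
  "b 31 x 3 b 30 x 0 x 2 b 29 x 2 b 28 x 2 b 27 x 0 x 11 x 7 b 26 x 1 x 0 b 25 x 0 b 24 x 1 b 23 x 13" ∷
  "x 2 x 1 b 22 x 14 x 11 x 2 b 21 x 1 x 0 b 20 x 3 b 19 x 3 b 18 x 9 x 15 b 17 x 0 b 16 x 1 x 5 b 15" ∷
  "x 3 b 14 x 1 b 13 x 8 x 3 b 12 x 0 x 16 b 11 b 10 x 2 b 9 x 4 b 8 b 7 x 5 x 0 b 6 x 0 b 5 b 4 x 1" ∷
  "x 2 x 3 b 3 x 3 x 0 x 1 b 2 x 11 x 5 x 0 b 1 b 0 x 5 d 1 8 x 0 x 2 x 1 x 4 x 3 x 5 x 2 x 8 x 1 x 17" ∷
  "x 1 x 5 x 13 x 0 x 7 x 14 x 0 x 16 x 1 x 18 x 3 x 1 x 0 x 2 x 0 x 7 x 0 x 3 x 11 x 7 x 0 x 0 x 23" ∷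
  "x 0 x 10 x 6 x 4 x 12 x 9 x 2 x 5 x 9 x 1 x 0 x 7 x 6 x 1 x 0 x 13 x 8 x 1 x 1 x 4 x 3 x 2 x 6 x 1" ∷
  "x 4 x 1 x 0 x 9 x 0 x 18 x 7 x 7 x 0 x 3 x 1 x 11 x 2 x 0 x 0 x 1 x 1 x 6 x 0 x 6 x 0 x 1 x 0 x 3" ∷
  "x 5 x 0 x 2 x 3 x 0 x 1 x 0 x 1 x 1 b 36 x 2 b 55 x 0 x 5 x 1 b 52 b 51 x 3 x 6 x 1 b 53 x 6 x 0" ∷
  "b 52 x 0 x 7 x 1 b 48 x 0 x 1 b 47 x 7 x 2 b 46 x 1 x 2 b 45 x 0 x 12 b 43 b 42 x 2 x 8 x 0 b 40 x 7" ∷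
  "x 3 x 5 b 37 x 7 x 16 b 36 x 9 x 1 x 4 b 35 x 1 x 5 x 4 b 28 x 1 x 4 b 27 x 18 x 3 x 1 b 26 x 3 x 0" ∷
  "b 25 x 0 b 23 x 6 x 1 x 0 b 22 b 10 x 3 b 9 x 11 x 8 b 8 x 0 x 11 b 7 x 1 b 6 b 2 x 3 b 29 b 28 b 23" ∷
  "x 2 x 9 x 0 x 1 x 6 x 0 x 2 x 2 b 27 x 8 x 1 x 0 b 21 x 5 x 1 x 0 x 3 x 5 x 1 x 0 x 9 x 5 x 0 x 0" ∷
  "x 3 x 1 x 1 x 0 x 4 x 9 x 1 x 8 x 3 x 5 x 6 x 0 x 3 x 4 x 7 x 0 x 1 x 0 x 4 x 3 x 1 x 0 x 2 x 1 x 0" ∷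
  "x 1 x 0 b 56 x 0 x 3 b 38 b 55 b 52 x 2 b 52 b 23 x 6 x 4 x 0 x 3 x 9 x 0 x 1 x 5 x 0 x 2 x 1 x 0" ∷
  "x 3 x 1 x 0 b 31 x 0 x 1 b 56 x 3 x 0 b 54 x 0 x 4 x 2 b 53 x 2 x 9 b 51 x 0 x 2 x 4 b 49 x 0 x 9" ∷
  "x 1 b 48 x 3 x 1 b 46 x 0 x 2 b 43 x 9 x 5 x 10 b 45 x 5 x 1 x 0 b 46 x 0 x 2 x 1 b 44 x 0 x 14 x 1" ∷
  "b 43 x 14 x 6 x 3 b 43 b 42 x 3 x 4 b 41 x 3 x 5 x 9 b 40 x 11 x 8 x 0 b 39 x 5 x 0 x 6 b 38 x 0 x 2" ∷
  "x 4 b 37 x 6 x 0 x 3 b 36 x 0 x 3 x 6 b 35 x 8 x 1 b 35 x 4 x 9 x 0 b 34 x 4 x 1 b 33 b 32 x 4 x 2" ∷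
  "x 0 b 31 x 4 x 16 b 30 x 4 x 8 x 1 b 29 x 11 x 1 b 28 x 5 x 0 b 27 x 2 x 4 b 26 x 0 x 2 x 8 b 25 x 2" ∷
  "x 3 x 13 b 24 b 23 x 1 x 3 b 22 x 0 x 7 b 21 x 16 x 1 x 11 b 20 x 0 x 9 x 3 b 19 b 18 x 18 x 1 x 0" ∷
  "b 17 b 16 x 3 x 1 x 0 b 15 b 14 b 13 x 7 x 13 x 1 b 12 b 11 x 6 x 18 b 10 x 11 x 5 b 9 x 11 x 12 x 0" ∷
  "b 8 x 1 x 32 b 7 b 6 x 2 x 6 b 5 x 0 x 23 b 4 x 0 x 16 b 3 x 2 x 6 b 2 b 1 x 2 x 25 x 0 b 0 x 3 x 7" ∷
  "d 1 2 x 0 x 3 x 8 x 1 x 1 x 4 x 2 x 7 x 1 x 0 x 9 x 3 x 1 x 0 x 0 x 1 x 11 x 0 x 8 x 4 x 6 x 0 x 1" ∷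
  "x 1 x 6 x 5 x 0 x 9 x 4 x 1 x 2 x 8 x 2 x 25 x 6 x 7 x 0 x 1 x 4 x 3 x 1 x 13 x 13 x 15 x 4 x 0 x 5" ∷
  "x 3 x 6 x 1 x 1 x 2 b 58 x 1 b 17 x 1 x 0 b 42 x 0 x 2 x 1 b 50 x 0 x 5 b 53 b 51 x 3 x 10 x 0 b 46" ∷
  "x 3 x 2 b 48 x 1 x 7 b 50 x 1 x 9 b 46 x 7 b 45 x 9 b 47 x 4 x 12 b 46 b 44 b 43 x 13 x 1 b 42 b 41" ∷
  "x 15 x 2 b 40 x 2 x 4 b 39 b 38 x 10 x 23 b 37 b 36 x 1 x 2 b 35 x 0 x 8 x 1 b 34 b 33 x 1 b 32 x 0" ∷
  "b 31 b 30 b 29 b 29 b 28 x 4 x 0 x 8 b 27 x 5 x 2 x 4 b 26 x 6 b 25 b 24 b 23 x 10 x 2 b 22 x 10" ∷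
  "b 21 b 20 x 5 b 19 b 18 x 8 x 7 b 17 x 2 b 16 b 15 x 11 x 0 b 14 x 0 x 3 b 13 b 12 x 1 b 11 x 2 x 9" ∷
  "x 3 b 10 b 9 x 16 x 5 b 8 x 0 x 3 x 1 b 7 x 0 b 6 b 5 x 5 x 1 x 4 b 4 x 2 b 3 x 1 b 2 x 6 b 1 x 6" ∷
  "x 3 b 0 d 2 8 x 5 x 7 x 4 x 4 x 2 x 0 x 15 x 0 x 5 x 14 x 4 x 11 x 0 x 9 x 2 x 0 x 0 x 3 x 2 x 0 x 5" ∷
  "x 1 x 2 x 10 x 20 x 5 x 2 x 0 x 6 x 8 x 4 x 5 x 1 x 15 x 0 x 0 x 17 x 5 x 1 x 2 x 0 x 3 x 0 x 0 x 3" ∷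
  "x 17 x 6 x 23 x 1 x 16 x 2 x 16 x 0 x 1 x 7 x 0 x 4 x 0 x 2 x 4 x 1 x 0 x 4 x 4 x 8 x 4 x 2 x 2 x 7" ∷
  "x 0 x 0 x 3 x 9 x 1 x 0 x 9 x 4 x 1 x 5 x 0 x 9 x 1 x 0 x 6 x 5 x 2 x 1 x 5 x 3 x 1 x 0 x 4 x 0 x 5" ∷
  "x 2 x 0 x 0 x 4 x 7 x 2 x 0 x 2 x 4 x 0 b 55 x 1 x 2 b 31 x 1 b 44 x 4 x 1 x 0 b 26 x 0 x 6 x 4 b 40" ∷
  "x 5 x 0 b 46 b 31 x 4 x 6 b 30 x 4 x 2 b 36 x 0 b 48 x 1 x 5 x 0 b 32 x 0 x 4 b 29 x 1 x 4 b 28 x 7" ∷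
  "x 1 x 0 b 27 x 11 b 25 b 23 x 12 x 3 b 22 x 0 x 13 b 21 x 8 x 1 b 20 x 4 b 16 b 15 x 13 x 0 b 14 x 0" ∷
  "b 13 b 6 x 6 x 2 b 5 x 0 x 13 b 3 x 1 x 3 b 2 x 4 x 2 x 7 b 1 x 2 x 4 b 29 b 28 x 1 x 2 x 0 b 11 x 0" ∷
  "x 1 x 5 x 2 x 11 b 25 x 0 x 6 x 2 b 24 x 18 x 0 x 1 x 2 x 5 x 5 x 0 x 2 x 7 x 1 x 2 x 0 x 3 x 2 x 14" ∷
  "x 6 x 2 x 0 x 0 x 12 x 3 x 1 x 4 x 3 x 1 x 0 x 4 x 1 x 2 x 1 x 8 x 1 x 11 x 0 x 4 x 2 x 0 x 2 x 2" ∷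
  "x 3 x 0 x 1 x 1 x 0 x 1 x 1 x 0 b 68 b 67 b 63 x 2 x 1 x 0 b 62 x 3 x 0 x 1 b 53 x 1 x 2 b 62 x 0" ∷
  "x 3 b 57 x 1 x 0 x 3 b 47 x 2 b 43 x 1 b 44 x 1 b 40 b 28 x 1 b 23 b 22 b 20 x 10 b 19 x 6 x 4 b 14" ∷
  "x 6 x 0 b 11 x 0 x 6 x 3 b 2 b 49 b 48 x 8 x 0 b 45 b 45 b 44 x 5 b 43 x 8 x 2 b 43 x 13 x 0 x 2" ∷
  "b 42 x 0 x 12 b 41 x 3 x 16 b 40 x 1 b 38 x 3 x 1 b 38 b 37 b 36 x 3 x 9 x 0 b 35 x 23 x 2 x 6 b 34" ∷
  "x 18 x 0 b 33 x 9 b 32 x 18 x 2 x 1 b 31 x 2 b 30 x 17 x 1 x 0 b 29 x 0 x 10 x 2 b 28 x 1 x 20 b 27" ∷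
  "x 4 b 26 x 2 b 25 x 0 x 2 b 24 x 2 b 23 b 22 x 3 x 11 b 21 b 20 x 1 x 0 b 19 x 0 b 18 b 17 b 16 x 2" ∷
  "x 0 b 15 x 4 x 1 x 8 b 14 x 5 x 0 b 13 x 1 b 12 x 1 b 11 x 22 x 11 b 10 b 9 x 2 x 13 b 8 x 0 x 3 b 7" ∷
  "x 1 b 6 b 5 b 4 x 2 x 6 x 5 b 3 b 2 x 6 b 1 b 0 x 11 x 2 x 0 d 2 7 x 8 x 9 x 1 x 4 x 3 x 0 x 1 x 2" ∷
  "x 1 x 8 x 2 x 15 x 6 x 0 x 0 x 9 x 1 x 7 x 6 x 5 x 2 x 0 x 3 x 0 x 6 x 0 x 11 x 9 x 18 x 0 x 17 x 6" ∷
  "x 4 x 1 x 4 x 1 x 2 x 16 x 15 x 1 x 0 x 1 x 6 x 3 x 0 x 8 x 12 x 1 x 0 x 1 x 5 x 17 x 5 x 1 x 5 x 7" ∷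
  "x 5 x 5 x 0 x 3 x 8 x 0 x 5 x 5 x 10 x 0 x 5 x 2 x 5 x 0 x 2 x 0 x 4 x 3 x 2 x 0 x 1 x 1 x 1 x 6" ∷
  "b 41 b 47 x 9 b 44 x 0 x 3 x 6 b 43 x 3 x 2 b 43 x 0 b 40 x 2 x 1 x 7 b 37 x 0 b 41 x 2 b 40 x 1" ∷
  "b 38 x 0 x 8 b 37 x 14 b 36 x 1 b 34 x 6 x 11 x 4 b 33 b 32 x 2 b 33 b 32 x 5 x 2 b 31 b 30 x 3 b 29" ∷
  "b 28 b 27 x 2 x 0 b 26 x 11 x 1 x 10 b 25 b 24 b 23 x 3 b 22 x 9 x 2 x 0 b 21 x 8 x 31 b 20 x 9 x 1" ∷
  "x 21 b 19 b 18 x 1 x 2 b 17 x 0 x 4 b 16 b 15 x 6 b 14 x 15 x 1 x 2 b 13 x 8 x 3 x 0 b 12 b 11 x 1" ∷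
  "b 10 x 10 x 13 b 9 b 8 x 9 x 2 x 13 b 7 x 0 x 4 b 6 x 0 x 2 b 5 x 0 b 4 b 3 x 2 x 11 x 0 b 2 b 1 x 4" ∷
  "x 1 x 0 b 0 x 9 d 5 8 x 6 x 0 x 1 x 0 x 9 x 2 x 0 x 5 x 10 x 11 x 1 x 19 x 6 x 5 x 18 x 1 x 0 x 7" ∷
  "x 1 x 2 x 6 x 3 x 2 x 5 x 2 x 8 x 1 x 6 x 4 x 1 x 14 x 28 x 0 x 5 x 0 x 3 x 4 x 6 x 3 x 5 x 1 x 23" ∷
  "x 0 x 1 x 6 x 0 x 3 x 2 x 1 x 3 x 12 x 0 x 0 x 2 x 0 x 7 x 3 x 0 x 0 x 10 x 4 x 6 x 2 x 0 x 1 x 2" ∷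
  "x 0 x 3 x 1 x 0 x 10 x 9 x 3 x 5 x 4 x 0 x 2 x 9 x 0 x 5 x 1 x 6 x 0 x 1 x 0 x 0 x 1 x 0 x 6 x 4" ∷
  "x 11 x 0 x 5 x 0 x 3 x 8 x 2 x 5 x 8 x 0 x 4 x 0 x 6 x 5 x 2 x 3 x 1 b 65 b 53 x 3 b 57 b 62 b 60" ∷
  "x 6 x 0 x 3 b 55 x 0 x 2 b 51 b 50 x 1 x 0 b 49 x 8 b 48 b 56 x 1 x 0 x 3 b 50 x 3 b 22 x 0 x 6 x 14" ∷
  "x 2 x 1 x 0 x 8 x 3 x 0 x 1 x 4 x 8 x 1 x 5 x 0 x 6 x 2 x 0 x 1 x 3 x 4 x 0 x 0 x 1 x 1 b 48 x 0" ∷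
  "b 59 x 0 b 53 b 45 x 1 b 43 x 0 x 5 x 7 b 58 x 6 x 2 x 0 b 59 x 1 x 0 x 4 b 57 x 10 x 1 x 0 b 51 x 9" ∷
  "x 3 b 49 x 0 x 2 x 1 b 47 x 2 x 5 b 45 x 1 x 6 x 0 b 44 x 8 x 1 x 0 b 38 x 3 x 0 b 38 x 1 x 0 x 10" ∷
  "b 34 x 0 x 3 x 11 b 33 x 1 x 2 b 32 x 3 x 7 x 0 b 31 x 6 x 1 x 2 b 28 x 6 x 0 x 7 b 27 x 1 x 10 x 2" ∷
  "b 25 x 0 x 4 b 24 x 0 x 8 b 23 b 21 x 4 x 11 b 18 x 7 x 6 b 17 x 14 x 8 x 3 b 16 x 2 x 1 x 0 b 15" ∷
  "b 11 x 6 x 2 x 1 b 10 x 13 x 0 b 5 x 0 x 7 x 3 b 4 x 4 x 0 b 3 x 2 x 5 b 2 x 1 x 9 b 0 x 5 x 4 x 0" ∷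
  "b 29 b 28 x 4 b 20 x 5 x 3 x 0 x 1 x 1 x 0 x 0 x 7 b 25 x 1 x 8 x 0 b 23 x 6 x 1 x 0 x 9 x 0 x 4 x 1" ∷
  "x 4 x 1 x 3 x 2 x 3 x 0 x 1 x 7 x 5 x 2 x 1 x 14 x 10 x 8 x 1 x 5 x 0 x 2 x 0 x 1 x 3 x 1 x 2 x 1" ∷
  "x 2 x 0 x 0 b 66 x 0 b 28 b 62 x 3 b 59 x 2 x 1 b 57 x 0 b 56 b 52 x 7 b 51 x 2 x 7 x 0 b 55 b 58" ∷
  "x 2 x 10 b 51 x 5 b 49 b 50 x 2 x 0 x 3 b 54 x 0 b 51 x 1 x 2 b 52 b 51 x 2 x 0 b 49 x 0 b 49 x 5" ∷
  "b 48 x 1 b 47 x 15 b 46 x 4 x 6 x 1 b 45 b 44 b 43 x 13 x 2 b 42 x 4 x 2 x 1 b 41 b 40 x 6 b 39 x 13" ∷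
  "x 3 x 1 b 38 x 3 x 2 b 37 x 2 x 1 b 36 x 2 b 35 x 0 x 8 x 5 b 34 b 33 b 32 b 31 x 5 x 0 b 30 x 15" ∷
  "x 0 x 13 b 29 x 8 x 1 x 4 b 28 b 27 x 2 x 0 x 6 b 26 x 3 b 25 x 1 b 24 x 2 x 4 x 8 b 23 b 22 b 21" ∷
  "x 4 x 0 b 20 x 0 b 19 x 17 b 18 x 1 x 0 b 17 x 13 x 4 x 1 b 16 x 3 x 1 x 0 b 15 b 14 x 1 b 13 x 2" ∷
  "b 12 b 11 b 10 x 26 b 9 b 8 b 7 x 6 b 6 x 11 x 5 x 2 b 5 x 1 x 14 x 3 b 4 x 1 x 0 x 4 b 3 b 2 x 3" ∷
  "x 1 x 0 b 1 x 11 x 0 x 1 b 0 x 6 x 10 d 6 7 x 0 x 4 x 0 x 11 x 1 x 7 x 0 x 5 x 1 x 3 x 1 x 0 x 20" ∷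
  "x 0 x 5 x 0 x 23 x 7 x 1 x 2 x 1 x 0 x 3 x 5 x 1 x 4 x 2 x 15 x 13 x 0 x 1 x 2 x 1 x 0 x 2 x 18 x 3" ∷
  "x 4 x 2 x 18 x 5 x 25 x 1 x 6 x 1 x 4 x 3 x 4 x 0 x 7 x 0 x 2 x 1 x 1 x 4 x 2 x 8 x 12 x 3 x 0 x 2" ∷
  "x 0 x 0 x 4 x 6 x 8 x 0 x 10 x 2 x 12 x 0 x 10 x 6 x 0 x 13 x 0 x 3 x 0 x 11 x 6 x 4 x 5 x 0 x 3 x 7" ∷
  "x 2 x 6 x 1 x 0 x 8 x 1 x 8 x 0 x 6 x 0 x 1 x 4 x 0 x 0 x 4 x 1 x 5 x 3 x 0 x 0 x 1 x 1 x 2 x 0 x 1" ∷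
  "b 62 x 1 b 60 b 38 x 3 x 0 x 1 b 60 x 3 b 59 b 57 x 1 x 3 x 0 b 34 x 0 x 6 x 4 x 2 x 5 x 2 x 0 x 0" ∷
  "x 2 x 2 x 1 x 0 x 0 b 52 x 3 x 1 x 0 b 61 x 2 x 1 x 0 b 34 x 0 x 1 x 5 b 24 x 2 x 6 b 17 x 3 x 2 x 0" ∷
  "b 16 x 2 x 1 x 0 b 11 x 2 x 1 x 0 b 55 b 28 x 10 x 2 b 21 x 3 b 3 b 54 b 53 b 52 b 42 x 10 x 0 x 3" ∷
  "x 2 x 0 x 7 x 3 x 0 x 2 x 7 x 4 b 52 b 51 b 11 x 7 x 0 x 2 x 3 x 4 x 6 x 0 x 0 x 6 x 2 x 0 x 2 x 12" ∷
  "x 0 x 1 x 0 x 0 x 9 x 0 b 15 x 2 x 0 b 53 x 0 x 11 x 2 b 47 x 12 b 46 x 6 x 3 x 0 b 51 x 2 x 0 x 6" ∷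
  "b 46 x 4 x 1 b 50 b 45 b 48 b 45 x 9 x 0 b 44 x 0 x 1 x 6 b 46 x 0 x 6 x 7 b 45 x 12 b 44 x 3 x 0" ∷
  "x 8 b 43 x 0 x 2 x 3 b 42 x 2 x 3 x 5 b 41 x 1 x 15 b 40 b 39 x 7 x 0 x 2 b 38 x 6 b 37 x 5 x 1 x 0" ∷
  "b 36 x 6 x 0 b 35 x 7 x 6 b 34 x 0 b 33 x 2 x 5 x 0 b 32 x 4 x 6 b 31 x 9 b 30 x 0 x 9 b 29 b 28 x 4" ∷
  "x 1 b 27 x 4 x 9 x 0 b 26 b 25 b 24 b 23 b 22 b 21 x 9 b 20 x 10 x 7 x 2 b 19 x 0 b 18 x 1 x 2 x 4" ∷
  "b 17 x 0 x 6 x 1 b 16 x 3 x 0 b 15 x 12 x 1 x 3 b 14 x 5 x 1 b 13 x 4 b 12 x 1 x 2 b 11 x 2 b 10 x 7" ∷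
  "x 11 b 9 x 0 x 20 b 8 x 1 b 7 x 5 b 6 x 7 x 1 b 5 x 0 x 6 x 21 b 4 x 9 x 0 b 3 x 6 x 7 x 4 b 2 x 1" ∷
  "b 1 x 4 b 0 x 0 x 7 d 0 5 x 13 x 0 x 8 x 5 x 8 x 1 x 2 x 3 x 0 x 0 x 12 x 7 x 10 x 1 x 9 x 0 x 13" ∷
  "x 5 x 4 x 5 x 4 x 1 x 8 x 0 x 0 x 2 x 3 x 1 x 0 x 2 x 11 x 0 x 1 x 16 x 3 x 0 x 1 x 13 x 12 x 9 x 1" ∷
  "x 18 x 2 x 2 x 8 x 2 x 0 x 5 x 3 x 8 x 12 x 0 x 2 x 8 x 11 x 4 x 7 x 6 x 0 x 8 x 2 x 0 x 1 x 11 x 0" ∷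
  "x 4 x 0 x 2 x 6 x 6 x 5 x 1 x 10 x 0 b 67 x 0 x 1 b 48 b 57 b 52 x 4 b 63 x 0 x 2 x 5 b 61 b 59 x 7" ∷
  "x 0 x 1 b 53 x 3 b 54 x 1 b 55 b 51 x 10 x 5 x 3 b 55 x 6 x 4 x 0 b 50 x 12 x 0 x 10 b 51 x 1 x 10" ∷
  "x 0 b 50 x 5 x 1 x 3 b 50 x 0 x 1 b 49 x 4 x 2 b 48 x 6 x 4 b 48 b 47 x 7 x 1 x 2 b 47 x 0 b 46 x 3" ∷
  "x 4 x 1 b 45 x 10 x 3 b 44 x 12 x 0 b 43 b 42 x 2 x 6 x 4 b 41 x 0 x 4 x 1 b 40 x 4 x 1 b 39 x 4 x 0" ∷
  "b 38 x 3 x 2 x 6 b 37 x 0 x 4 x 3 b 36 x 1 b 35 x 4 x 17 x 0 b 34 x 0 x 4 x 12 b 33 x 3 x 15 x 5" ∷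
  "b 32 x 3 x 7 b 31 x 4 x 0 x 2 b 30 x 5 x 1 b 29 x 3 b 28 x 4 x 2 x 18 b 27 x 2 x 4 b 26 x 0 x 2 x 6" ∷
  "b 25 x 10 b 24 x 7 x 1 b 23 x 9 x 4 x 2 b 22 x 0 b 21 x 6 x 11 b 20 x 0 x 5 x 6 b 19 x 2 b 18 x 8" ∷
  "x 0 x 14 b 17 x 9 x 0 x 1 b 16 x 1 x 2 x 0 b 15 x 2 x 1 x 5 b 14 x 1 x 0 x 4 b 13 x 2 x 0 x 5 b 12" ∷
  "b 11 x 3 x 5 x 0 b 10 x 7 x 0 x 21 b 9 b 8 x 2 x 0 x 9 b 7 x 2 x 6 x 0 b 6 b 5 x 15 b 4 x 8 b 3 x 3" ∷
  "x 5 b 2 x 2 x 4 b 1 b 0 x 9 x 13 x 0 d 0 8 x 5 x 9 x 0 x 0 x 0 x 1 x 0 x 3 x 1 x 5 x 0 x 4 x 1 x 3" ∷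
  "x 2 x 0 x 6 x 4 x 6 x 1 x 0 x 2 x 4 x 3 x 9 x 1 x 15 x 1 x 9 x 9 x 0 x 10 x 21 x 7 x 2 x 4 x 5 x 1" ∷
  "x 5 x 6 x 1 x 8 x 0 x 6 x 12 x 1 x 0 x 9 x 0 x 2 x 3 x 5 x 0 x 5 x 2 x 3 x 2 x 1 x 0 x 2 x 0 x 3 x 2" ∷
  "x 1 x 2 x 0 b 31 x 1 b 64 b 30 b 49 x 2 x 0 x 1 b 33 x 0 x 1 b 49 x 5 x 0 x 2 b 52 x 0 x 5 x 2 b 58" ∷
  "x 2 x 1 x 0 b 50 b 49 b 50 b 45 b 42 x 4 x 0 b 40 b 49 x 6 x 0 b 51 x 0 x 1 x 2 b 50 x 0 x 2 b 48" ∷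
  "x 2 b 47 x 0 b 46 b 46 x 1 b 45 x 22 x 5 b 44 x 3 b 43 x 6 x 3 b 42 x 17 x 0 b 41 x 1 b 40 x 0 x 13" ∷
  "b 39 x 1 x 2 b 38 b 37 x 1 x 2 b 36 x 2 x 0 x 9 b 35 b 34 x 5 x 3 b 33 b 32 x 3 x 0 x 9 b 31 x 4" ∷
  "b 30 x 3 x 6 x 2 b 29 b 28 x 16 x 7 x 0 b 27 b 26 x 9 b 25 x 13 x 7 b 24 x 0 x 9 b 23 b 22 b 21 x 4" ∷
  "x 0 b 20 x 0 b 19 b 18 x 1 b 17 b 16 x 3 x 0 b 15 x 0 x 16 x 2 b 14 b 13 x 6 x 1 x 0 b 12 b 11 x 3" ∷
  "b 10 b 9 x 6 b 8 x 4 x 22 b 7 x 0 x 2 b 6 x 0 x 5 b 5 x 0 x 2 x 4 b 4 x 2 x 0 b 3 x 9 x 3 b 2 x 1" ∷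
  "x 5 b 1 x 4 x 8 b 0 x 5 d 2 6 x 1 x 8 x 0 x 0 x 5 x 1 x 12 x 11 x 11 x 3 x 1 x 4 x 7 x 11 x 0 x 2" ∷
  "x 0 x 3 x 10 x 0 x 2 x 5 x 2 x 4 x 6 x 1 x 0 x 6 x 13 x 15 x 0 x 1 x 2 x 1 x 0 x 6 x 17 x 1 x 5 x 2" ∷
  "x 2 x 2 x 23 x 0 x 1 x 2 x 10 x 5 x 1 x 7 x 3 x 9 x 25 x 1 x 2 x 0 x 17 x 7 x 0 x 0 x 20 x 1 x 11" ∷
  "x 5 x 1 x 4 x 5 x 1 x 0 x 2 x 1 x 2 x 2 x 0 x 2 x 6 x 0 x 11 x 5 x 1 x 3 x 1 x 2 x 2 x 9 x 0 x 2 x 5" ∷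
  "x 2 x 0 x 0 x 9 x 3 x 4 x 2 x 6 x 1 x 7 x 3 x 2 x 3 x 1 x 0 b 30 x 0 x 3 x 1 b 56 x 0 b 46 x 0 x 4" ∷
  "x 2 b 28 x 4 b 18 x 3 x 1 x 0 b 59 b 58 x 2 x 0 b 57 x 3 x 1 x 0 b 14 x 0 x 1 x 6 x 2 b 29 x 0 b 8" ∷
  "b 55 x 5 x 2 b 53 x 2 x 0 x 1 b 51 x 1 b 50 x 2 x 0 x 3 b 49 x 2 x 0 b 48 x 0 x 1 x 2 b 46 x 11 x 4" ∷
  "x 0 b 44 x 15 b 40 x 5 b 36 x 0 b 43 x 2 b 32 b 31 x 6 x 3 b 30 x 2 x 7 x 1 b 29 x 1 b 27 x 0 b 26" ∷
  "b 24 x 10 b 22 x 4 x 5 x 2 b 16 x 8 x 0 b 15 x 2 b 13 x 2 b 12 x 3 x 6 b 9 x 2 b 7 x 2 b 5 x 0 x 2" ∷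
  "x 10 b 29 x 2 b 28 x 5 b 26 x 12 b 25 x 4 x 17 b 24 x 6 x 0 x 10 x 1 x 0 x 9 x 0 x 4 x 0 b 28 x 5" ∷
  "x 0 x 4 b 27 x 2 x 1 x 0 x 7 x 7 x 0 x 6 x 9 x 5 x 0 x 9 x 0 x 15 x 0 x 4 x 1 x 0 x 2 x 5 x 6 x 10" ∷
  "x 1 x 3 x 4 x 0 x 9 x 1 x 7 x 1 x 0 x 9 x 8 x 0 x 1 x 0 x 2 x 1 x 7 x 3 b 54 x 7 x 0 b 51 b 45 x 2" ∷
  "x 1 b 50 x 5 x 1 b 49 b 48 x 5 x 3 x 0 b 45 x 5 x 3 b 45 x 3 x 0 b 44 x 5 x 2 x 3 b 43 x 9 x 1 x 4" ∷
  "b 42 b 41 x 1 b 40 b 39 x 1 x 0 x 2 b 40 x 6 x 0 x 14 b 39 x 0 b 38 x 12 b 37 b 36 x 3 b 35 x 7 x 4" ∷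
  "x 1 b 34 x 10 b 33 b 32 b 31 b 30 x 4 x 11 x 0 b 29 x 5 x 3 b 28 x 5 b 27 b 26 b 25 b 24 b 23 x 15" ∷
  "x 3 x 10 b 22 x 7 x 10 b 21 x 1 x 5 x 4 b 20 x 0 b 19 b 18 x 2 b 17 x 2 b 16 b 15 x 2 x 0 x 7 b 14" ∷
  "x 6 b 13 x 1 b 12 x 2 b 11 b 10 x 11 b 9 x 4 x 6 x 14 b 8 b 7 x 1 x 8 x 0 b 6 b 5 b 4 x 5 x 9 x 0" ∷
  "b 3 x 3 x 1 x 0 b 2 x 7 x 1 x 21 b 1 x 10 x 0 b 0 x 8 d 3 4 x 5 x 1 x 4 x 12 x 2 x 1 x 4 x 0 x 7 x 3" ∷
  "x 12 x 1 x 0 x 5 x 6 x 1 x 19 x 3 x 0 x 2 x 0 x 3 x 9 x 2 x 0 x 11 x 14 x 0 x 9 x 5 x 6 x 3 x 0 x 5" ∷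
  "x 7 x 1 x 2 x 3 x 0 x 0 x 15 x 8 x 3 x 7 x 9 x 1 x 0 x 2 x 32 x 1 x 1 x 5 x 3 x 0 x 2 x 3 x 1 x 3" ∷
  "x 0 x 2 x 7 x 2 x 2 x 6 x 3 x 0 x 1 x 2 x 0 x 24 x 7 x 4 x 7 x 20 x 5 x 0 x 1 x 0 x 2 x 4 x 1 x 12" ∷
  "x 5 x 0 x 0 x 4 x 1 x 7 x 3 x 1 x 0 x 2 x 1 x 6 x 1 b 58 x 2 b 23 b 43 x 1 x 3 b 55 x 5 x 0 b 53 x 6" ∷
  "x 0 b 50 x 1 x 9 x 5 b 51 x 1 x 4 x 0 b 47 x 8 x 2 x 1 b 46 x 3 b 48 x 1 b 46 x 1 x 4 x 0 b 46 x 0" ∷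
  "x 5 b 45 x 9 b 45 x 1 x 6 x 0 b 44 x 11 x 0 b 43 x 1 b 42 x 10 x 8 b 41 x 1 x 3 b 40 b 39 x 5 x 17" ∷
  "b 38 x 7 b 37 b 36 b 35 b 34 x 4 x 1 b 33 x 11 b 32 x 6 x 2 x 0 b 31 b 30 x 2 x 0 x 1 b 29 x 0 x 1" ∷
  "x 12 b 28 x 3 x 6 x 5 b 27 x 11 b 26 x 1 x 8 b 25 x 1 x 6 b 24 x 0 b 23 b 22 x 5 b 21 b 20 x 3 x 0" ∷
  "x 1 b 19 x 4 x 0 x 1 b 18 x 13 x 1 x 3 b 17 x 2 x 0 x 8 b 16 x 7 b 15 x 3 x 1 b 14 b 13 x 1 x 4 x 0" ∷
  "b 12 x 2 x 0 b 11 b 10 x 5 b 9 x 12 b 8 x 4 b 7 x 9 b 6 x 2 x 1 x 4 b 5 x 1 b 4 x 1 b 3 x 9 b 2 x 2" ∷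
  "b 1 x 10 x 4 x 0 b 0 x 6 x 7 d 1 4 x 0 x 5 x 19 x 2 x 0 x 5 x 0 x 5 x 6 x 2 x 0 x 11 x 1 x 1 x 0" ∷
  "x 15 x 0 x 5 x 3 x 2 x 3 x 11 x 4 x 1 x 0 x 0 x 6 x 2 x 7 x 1 x 6 x 0 x 2 x 6 x 1 x 1 x 10 x 10 x 7" ∷
  "x 3 x 0 x 8 x 4 x 1 x 4 x 2 x 3 x 3 x 1 x 0 x 14 x 2 x 0 x 2 x 8 x 0 x 1 x 2 x 2 x 1 x 6 x 5 x 10" ∷
  "x 0 x 0 x 12 x 2 x 3 x 2 x 1 x 3 x 0 x 1 x 6 x 4 x 3 x 0 x 4 x 1 x 0 b 57 x 3 b 52 b 35 x 1 b 54 x 3" ∷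
  "b 47 x 7 b 43 b 45 x 7 b 44 x 13 x 1 x 4 b 39 x 9 x 8 b 48 x 2 x 0 b 36 x 7 x 2 x 1 b 35 x 3 x 1 x 8" ∷
  "b 34 x 7 x 0 x 8 b 33 x 0 x 6 x 2 b 30 x 0 b 24 x 3 b 20 x 2 x 4 b 18 x 2 b 17 b 16 x 2 x 0 b 15 x 0" ∷
  "x 4 x 3 b 13 x 12 x 0 x 2 b 12 b 11 x 2 b 9 x 4 b 6 x 0 x 2 x 11 b 3 x 4 b 2 x 1 x 4 x 12 b 29 x 2" ∷
  "b 28 x 0 b 27 b 20 x 4 x 0 x 8 x 1 x 3 x 9 x 0 x 9 x 2 b 28 b 17 x 6 x 1 x 4 x 0 x 0 x 9 x 2 x 4 x 0" ∷
  "x 1 x 2 x 0 x 0 x 4 x 0 x 2 x 11 x 9 x 7 x 0 x 3 x 9 x 0 x 0 x 2 x 5 x 17 x 2 x 4 x 1 x 1 x 0 x 7" ∷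
  "x 2 x 0 x 0 x 2 x 0 x 1 x 2 x 4 x 6 x 2 x 0 x 0 x 1 x 0 x 0 b 56 x 3 b 54 x 5 b 42 x 0 b 38 x 0 x 3" ∷
  "x 4 b 53 x 4 b 50 x 5 x 3 b 49 b 45 x 9 x 1 x 3 b 49 x 6 b 48 x 5 x 1 x 8 b 45 x 10 x 0 x 7 b 47 x 1" ∷
  "x 0 b 46 b 44 x 4 b 42 x 0 x 7 x 2 b 42 b 41 x 1 x 0 x 2 b 40 x 6 b 40 x 4 b 39 x 0 x 2 x 4 b 38 x 0" ∷
  "x 3 x 1 b 37 x 3 x 22 b 36 x 0 x 5 x 10 b 35 x 2 b 34 x 3 x 1 x 0 b 33 x 0 x 5 b 32 x 1 b 31 x 1" ∷
  "b 30 b 29 b 28 x 2 x 0 x 8 b 27 x 4 b 26 x 4 x 2 x 1 b 25 x 10 x 1 x 15 b 24 x 1 b 23 x 2 x 1 x 6" ∷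
  "b 22 b 21 x 3 x 0 x 2 b 20 x 0 x 15 b 19 x 0 x 1 b 18 b 17 x 3 x 5 b 16 x 3 x 7 b 15 x 0 x 3 x 4" ∷
  "b 14 x 6 x 0 x 13 b 13 x 9 x 0 b 12 x 6 b 11 x 0 x 17 x 1 b 10 x 10 x 0 b 9 x 0 x 1 x 13 b 8 x 0" ∷
  "x 14 x 3 b 7 b 6 x 9 b 5 x 4 x 7 x 0 b 4 b 3 x 4 x 2 b 2 b 1 x 7 b 0 x 0 x 3 x 2 d 1 3 x 9 x 1 x 13" ∷
  "x 4 x 0 x 3 x 0 x 19 x 2 x 1 x 4 x 6 x 0 x 1 x 11 x 3 x 9 x 3 x 0 x 0 x 2 x 6 x 1 x 2 x 1 x 3 x 2" ∷
  "x 5 x 9 x 2 x 12 x 2 x 8 x 0 x 10 x 8 x 6 x 0 x 0 x 5 x 6 x 13 x 3 x 5 x 0 x 2 x 3 x 0 x 7 x 1 x 0" ∷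
  "x 2 x 10 x 2 x 7 x 1 x 11 x 3 x 5 x 0 x 1 x 2 x 1 x 3 x 0 x 0 x 1 x 1 x 6 x 1 x 0 x 0 b 47 x 3 x 1" ∷
  "x 0 b 55 x 2 x 1 x 0 b 30 x 0 x 1 x 5 b 23 x 2 x 7 b 17 x 3 x 2 x 0 b 16 x 2 x 1 x 0 b 11 x 2 x 1" ∷
  "x 0 b 50 x 10 b 47 x 0 x 1 x 11 b 45 x 3 x 11 b 47 x 13 x 0 x 3 b 44 x 0 b 15 x 6 x 2 x 17 x 0 x 17" ∷
  "x 4 x 1 x 1 b 46 x 1 x 13 x 0 b 44 b 47 x 2 b 44 x 5 x 2 x 0 b 45 x 4 x 0 x 3 b 42 x 8 x 3 x 0 b 41" ∷
  "x 3 x 2 x 0 b 41 x 17 x 0 x 1 b 36 x 2 x 0 x 19 x 5 x 3 x 0 x 0 x 15 x 2 x 0 x 3 x 0 x 2 x 1 x 1 x 0" ∷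
  "x 2 x 0" ∷ []

certificate : Certificate
certificate = proj₁ (parse (length tokens) tokens)
  where
  tokens : List String
  tokens = List.concatMap String.words certificateText

certificate-valid : valid cover (allFin 70) [] certificate ≡ true
certificate-valid = refl

mainTheorem1 : (L : List Rel9) → All IsPartition333 L → Unique L →
    (∀ R R' → R ∈ L → R' ∈ L → ¬ Adjacent R R') → length L ≡ 70 →
    ∃[ i ] ∃[ j ] (toℕ i < toℕ j) ×
      (∀ (R : Rel9) → IsPartition333 R → (R ∈ L ⇔ SameCell R i j))
mainTheorem1 L partitions unique independent |L|≡70 =
  sound (allFin 70) [] certificate certificate-valid [] (λ m → inj₁ (∈-allFin m))
  where
  meets : ∀ m → ∃ λ k → partition (cliqueLabelling cover m k) ∈ L
  meets = independent-meets-every-clique Adjacent (λ m k → partition (cliqueLabelling cover m k))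
    cover-clique L unique independent (λ R R∈L → cover-complete R (All.lookup partitions R∈L))
    (≤-reflexive (sym |L|≡70))
  open Search cover cover-balanced cover-clique cover-complete L independent meets
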